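{- Suppose $w\in S_n$ avoids $3412$ and let $(i,w_i)$ be a non-corner of $\Gamma_{[e,w]}$. Let $u\in S_{n-1}$ be the permutation $\delta_i(j)\mapsto\delta_{w_i}(w_j)$ ($j\neq i$). Let $\overline{S}_w$ and $\overline{S}_u$ be the sets of spanning corners of $\Gamma_{[e,w]}$ and $\Gamma_{[e,u]}$. Then: (1) for $j\in[n]\setminus\{i\}$, $(j,w_j)\in\overline{S}_w$ if and only if $(\delta_i(j),\delta_{w_i}(w_j))\in\overline{S}_u$; (2) the map $\beta:\{B_{j,w_j}:(j,w_j)\in\overline{S}_w\}\to\{B_{k,u_k}:(k,u_k)\in\overline{S}_u\}$, $B_{j,w_j}\mapsto B_{\delta_i(j),\delta_{w_i}(w_j)}$, is a well-defined color-preserving bijection (each bounding box and its image have the same colors, so red, green, blue and purple boxes go to boxes of the same kind); (3) if the bounding boxes of $\Gamma_{[e,w]}$ and of $\Gamma_{[e,u]}$ are each ordered by the row of their northwest corner, then $\beta$ preserves this ordering.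
   Context: $S_m$ in one-line notation, $e$ the identity, Bruhat order. For $w\in S_m$, $\Gamma_{[e,w]}:=\{(r,x_r): x\le w,\ r\in[m]\}\subseteq[m]^2$ ((r,c) = row $r$, column $c$). An inversion of $w$ is a pair $\langle k,l\rangle$ with $k<l$, $w_k>w_l$. The cell $(i,w_i)$ is a non-corner of $\Gamma_{[e,w]}$ if it is sandwiched by an inversion, i.e. there exist $k<i<l$ with $w_k>w_i>w_l$; otherwise it is a corner. For $a\in[n]$, $\delta_a:[n]\setminus\{a\}\to[n-1]$ is $\delta_a(j)=j$ for $j<a$, $j-1$ for $j>a$. For a permutation $w$, $B_{j,w_j}$ is the square region with corners $(j,j),(j,w_j),(w_j,j),(w_j,w_j)$; it is a bounding box if not properly contained in any $B_{k,w_k}$, and then $(j,w_j)$ is a spanning corner. A bounding box $B_{j,w_j}$ is red if $j>w_j$, green if $j=w_j$, blue if $j<w_j$; a bounding box arising from both a red and a blue spanning corner (i.e. $B_{j,w_j}=B_{w_j,j}$ with both $(j,w_j)$ and $(w_j,j)$ spanning corners, $j\ne w_j$) is called purple. -}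

module Defs where

open import Data.Nat using (ℕ; suc; _<_; _≤_; _⊔_; _⊓_)
open import Data.Fin using (Fin; toℕ; punchOut)
open import Data.Fin.Permutation using (Permutation′; _⟨$⟩ʳ_; _⟨$⟩ˡ_; inverseˡ)
open import Data.Product using (Σ; ∃; _×_; _,_)
open import Relation.Binary.PropositionalEquality using (_≡_; _≢_; cong; trans; sym)
open import Relation.Nullary using (¬_)

-- w(j) as a natural number (1-based vs 0-based is irrelevant for all notions below)
val : ∀ {n} → Permutation′ n → Fin n → ℕ
val w j = toℕ (w ⟨$⟩ʳ j)

Contains3412 : ∀ {n} → Permutation′ n → Set
Contains3412 {n} w = Σ (Fin n) λ a → Σ (Fin n) λ b → Σ (Fin n) λ c → Σ (Fin n) λ d →
  (toℕ a < toℕ b) × (toℕ b < toℕ c) × (toℕ c < toℕ d) ×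
  (val w c < val w d) × (val w d < val w a) × (val w a < val w b)

Avoids3412 : ∀ {n} → Permutation′ n → Set
Avoids3412 w = ¬ Contains3412 w

-- (i, w_i) is a non-corner of Γ_[e,w]: sandwiched by an inversion
NonCorner : ∀ {n} → Permutation′ n → Fin n → Set
NonCorner {n} w i = Σ (Fin n) λ k → Σ (Fin n) λ l →
  (toℕ k < toℕ i) × (toℕ i < toℕ l) × (val w i < val w k) × (val w l < val w i)

-- The square B_{j,w_j} is [lo,hi] × [lo,hi] with lo = min(j,w_j), hi = max(j,w_j);
-- we represent it by the pair (lo , hi).
lo : ∀ {n} → Permutation′ n → Fin n → ℕ
lo w j = toℕ j ⊓ val w j

hi : ∀ {n} → Permutation′ n → Fin n → ℕ
hi w j = toℕ j ⊔ val w j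

Box : ∀ {n} → Permutation′ n → Fin n → ℕ × ℕ
Box w j = lo w j , hi w j

BoxSub : ∀ {n} → Permutation′ n → Fin n → Fin n → Set
BoxSub w j k = (lo w k ≤ lo w j) × (hi w j ≤ hi w k)

ProperSub : ∀ {n} → Permutation′ n → Fin n → Fin n → Set
ProperSub w j k = BoxSub w j k × (Box w j ≢ Box w k)

Spanning : ∀ {n} → Permutation′ n → Fin n → Set
Spanning {n} w j = ¬ (Σ (Fin n) λ k → ProperSub w j k)

Red : ∀ {n} → Permutation′ n → ℕ × ℕ → Set
Red {n} w B = Σ (Fin n) λ j → Spanning w j × (Box w j ≡ B) × (val w j < toℕ j)

Green : ∀ {n} → Permutation′ n → ℕ × ℕ → Set
Green {n} w B = Σ (Fin n) λ j → Spanning w j × (Box w j ≡ B) × (val w j ≡ toℕ j)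

Blue : ∀ {n} → Permutation′ n → ℕ × ℕ → Set
Blue {n} w B = Σ (Fin n) λ j → Spanning w j × (Box w j ≡ B) × (toℕ j < val w j)

Purple : ∀ {n} → Permutation′ n → ℕ × ℕ → Set
Purple w B = Red w B × Blue w B

-- injectivity of a permutation, in the form needed to apply δ_{w_i} to w_j
perm-≢ : ∀ {n} (w : Permutation′ n) {i j : Fin n} → i ≢ j → w ⟨$⟩ʳ i ≢ w ⟨$⟩ʳ j
perm-≢ w {i} {j} i≢j e = i≢j (trans (sym (inverseˡ w)) (trans (cong (w ⟨$⟩ˡ_) e) (inverseˡ w)))

δ : ∀ {m} (a : Fin (suc m)) {j : Fin (suc m)} → a ≢ j → Fin m
δ a p = punchOut p

module Submission where

-- Write r j, c j for the row and column of the j-th cell of w and let (I , W)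
-- be the deleted cell (i , w_i).  Deleting it moves every other cell to
-- (shift I (r j) , shift W (c j)), where shift a is the order-preserving map
-- ℕ ∖ {a} → ℕ underlying punchOut.  Up to transposing w (which swaps rows and
-- columns, red and blue, and preserves 3412-avoidance) we may assume I ≤ W;
-- the non-corner hypothesis then supplies a cell k0 north-east of (I , W).
--
-- The only non-local inputs there are
-- 3412-avoidance and a counting fact ("crossings" of a horizontal line by the
-- permutation matrix balance), proved by pigeonhole in module Crossings.

open import Defs
open import Data.Nat using (ℕ; zero; suc; _<_; _≤_; _⊓_; _⊔_; s≤s; pred; _≤?_; _<?_)
open import Data.Nat.Properties
open import Data.Fin using (Fin; toℕ; fromℕ<; punchOut; punchIn) renaming (zero to fz; suc to fs)
open import Data.Fin.Properties using (toℕ-injective; toℕ-fromℕ<; toℕ<n; any?; pigeonhole; punchOut-injective; punchInᵢ≢i; punchOut-punchIn) renaming (_≟_ to _≟F_)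
open import Data.Fin.Permutation using (Permutation′; _⟨$⟩ʳ_; _⟨$⟩ˡ_; inverseˡ; inverseʳ)
open import Data.Product using (Σ; _×_; _,_; proj₁; proj₂; ∃)
open import Data.Sum using (_⊎_; inj₁; inj₂)
open import Data.Empty using (⊥; ⊥-elim)
open import Function using (_∘_)
open import Function.Bundles using (_⇔_; mk⇔; Equivalence)
open import Relation.Nullary using (¬_; yes; no; Dec)
open import Relation.Nullary.Decidable using (¬?; _×-dec_)
open import Relation.Binary.Definitions using (Tri; tri<; tri≈; tri>)
open import Relation.Binary.PropositionalEquality

open Equivalence

shift : ℕ → ℕ → ℕ
shift zero zero = zero
shift zero (suc x) = x
shift (suc a) zero = zero
shift (suc a) (suc x) = suc (shift a x)

shift-below : ∀ {a x} → x ≤ a → shift a x ≡ x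
shift-below {zero} {zero} _ = refl
shift-below {suc a} {zero} _ = refl
shift-below {suc a} {suc x} (s≤s p) = cong suc (shift-below p)

shift-above : ∀ {a x} → a < x → suc (shift a x) ≡ x
shift-above {zero} {suc x} _ = refl
shift-above {suc a} {suc x} (s≤s p) = cong suc (shift-above p)

-- On indices, δ is exactly shift: this is how u is expressed through w.
toℕ-punchOut : ∀ {m} {i j : Fin (suc m)} (p : i ≢ j) → toℕ (punchOut p) ≡ shift (toℕ i) (toℕ j)
toℕ-punchOut {_} {fz} {fz} p = ⊥-elim (p refl)
toℕ-punchOut {_} {fz} {fs j} p = refl
toℕ-punchOut {suc m} {fs i} {fz} p = refl
toℕ-punchOut {suc m} {fs i} {fs j} p = cong suc (toℕ-punchOut (p ∘ cong fs))

data Shifted (a x x' : ℕ) : Set where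
  below : x < a → x' ≡ x → Shifted a x x'
  above : a < x → suc x' ≡ x → Shifted a x x'

shifted : ∀ a x → x ≢ a → Shifted a x (shift a x)
shifted a x ne with <-cmp x a
... | tri< p _ _ = below p (shift-below (<⇒≤ p))
... | tri≈ _ e _ = ⊥-elim (ne e)
... | tri> _ _ p = above p (shift-above p)

shifted-≤ : ∀ {a x x'} → Shifted a x x' → x' ≤ x
shifted-≤ (below _ refl) = ≤-refl
shifted-≤ (above _ refl) = n≤1+n _

shift-mono : ∀ {a x x' z z'} → Shifted a x x' → Shifted a z z' → x ≤ z → x' ≤ z'
shift-mono (below _ refl) (below _ refl) le = le
shift-mono (below xa refl) (above q refl) le = ≤-trans (<⇒≤ xa) (≤-pred q)
shift-mono (above _ refl) (below _ refl) le = ≤-trans (n≤1+n _) le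
shift-mono (above _ refl) (above _ refl) le = ≤-pred le

unshift-mono : ∀ {a x x' z z'} → Shifted a x x' → Shifted a z z' → x' ≤ z' → x ≤ z
unshift-mono (below _ refl) (below _ refl) le = le
unshift-mono (below xa refl) (above az refl) le = <⇒≤ (<-trans xa az)
unshift-mono (above p refl) (below za refl) le = ⊥-elim (<-irrefl refl (<-≤-trans za (≤-trans (≤-pred p) le)))
unshift-mono (above _ refl) (above _ refl) le = s≤s le

-- A row value x loses the gap I, a column value y the gap W, with I ≤ W.
-- Rows strictly between the gaps move down while columns there stay, so a
-- comparison "row vs column" survives except in that band, where a tie can
-- disappear (x = y ↦ x' < y') or appear (x = y + 1 ↦ x' = y').  The names say
-- the direction (shift: w to u, unshift: u to w) and the relation x ≤ y, x ≥ y.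
module TwoGaps {I W : ℕ} (IW : I ≤ W) where
  shift-≤ : ∀ {x x' y y'} → Shifted I x x' → Shifted W y y' → x ≤ y → x' ≤ y'
  shift-≤ (below _ refl) (below _ refl) le = le
  shift-≤ (below xI refl) (above q refl) le = <⇒≤ (<-≤-trans xI (≤-trans IW (≤-pred q)))
  shift-≤ (above _ refl) (below _ refl) le = ≤-trans (n≤1+n _) le
  shift-≤ (above _ refl) (above _ refl) le = ≤-pred le

  shift-< : ∀ {x x' y y'} → Shifted I x x' → Shifted W y y' → x < y → x' < y'
  shift-< (below _ refl) (below _ refl) lt = lt
  shift-< (below xI refl) (above q refl) lt = <-≤-trans xI (≤-trans IW (≤-pred q))
  shift-< (above _ refl) (below _ refl) lt = <-trans (n<1+n _) lt
  shift-< (above _ refl) (above _ refl) lt = ≤-pred lt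

  unshift-≥ : ∀ {x x' y y'} → Shifted I x x' → Shifted W y y' → y' ≤ x' → y ≤ x
  unshift-≥ {x} {x'} {y} {y'} p q le with y ≤? x
  ... | yes r = r
  ... | no r = ⊥-elim (<⇒≱ (shift-< p q (≰⇒> r)) le)

  unshift-> : ∀ {x x' y y'} → Shifted I x x' → Shifted W y y' → y' < x' → y < x
  unshift-> {x} {x'} {y} {y'} p q lt with x ≤? y
  ... | yes r = ⊥-elim (<⇒≱ lt (shift-≤ p q r))
  ... | no r = ≰⇒> r

  shift-≥ : ∀ {x x' y y'} → Shifted I x x' → Shifted W y y' → y ≤ x → y' ≤ x' ⊎ (y ≡ x × I < x × x < W)
  shift-≥ (below _ refl) (below _ refl) le = inj₁ le
  shift-≥ (below xI refl) (above Wy refl) le = ⊥-elim (<-irrefl refl (<-trans (<-≤-trans xI IW) (<-≤-trans Wy le)))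
  shift-≥ {suc x'} {x'} {y} (above Ix refl) (below yW refl) le with y ≤? x'
  ... | yes r = inj₁ r
  ... | no r = let e = ≤-antisym le (≰⇒> r) in inj₂ (e , Ix , subst (_< W) e yW)
  shift-≥ (above _ refl) (above _ refl) le = inj₁ (≤-pred le)

  unshift-≤ : ∀ {x x' y y'} → Shifted I x x' → Shifted W y y' → x' ≤ y' → x ≤ y ⊎ (x ≡ suc y × I ≤ y × y < W)
  unshift-≤ (below _ refl) (below _ refl) le = inj₁ le
  unshift-≤ (below _ refl) (above _ refl) le = inj₁ (≤-trans le (n≤1+n _))
  unshift-≤ {suc x'} {x'} {y} (above Ix refl) (below yW refl) le with suc x' ≤? y
  ... | yes r = inj₁ r
  ... | no r = let e = ≤-antisym le (≤-pred (≰⇒> r)) in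
      inj₂ (cong suc e , subst (I ≤_) e (≤-pred Ix) , yW)
  unshift-≤ (above _ refl) (above _ refl) le = inj₁ (s≤s le)

  shift-≡ : ∀ {x x' y y'} → Shifted I x x' → Shifted W y y' → x ≡ y → x' ≡ y' ⊎ (I < x × x < W)
  shift-≡ (below _ refl) (below _ refl) e = inj₁ e
  shift-≡ (below xI refl) (above Wy refl) e = ⊥-elim (<-irrefl refl (<-trans (<-≤-trans xI IW) (subst (W <_) (sym e) Wy)))
  shift-≡ (above Ix refl) (below yW refl) e = inj₂ (Ix , subst (_< W) (sym e) yW)
  shift-≡ (above _ refl) (above _ refl) e = inj₁ (suc-injective e)

  unshift-≡ : ∀ {x x' y y'} → Shifted I x x' → Shifted W y y' → x' ≡ y' → x ≡ y ⊎ (x ≡ suc y × I ≤ y × y < W)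
  unshift-≡ p q e with unshift-≤ p q (≤-reflexive e)
  ... | inj₁ le = inj₁ (≤-antisym le (unshift-≥ p q (≤-reflexive (sym e))))
  ... | inj₂ b = inj₂ b


Maximal : {X : Set} (L H : X → ℕ) → X → Set
Maximal {X} L H j = ∀ (k : X) → L k ≤ L j × H j ≤ H k → L j ≡ L k × H j ≡ H k

module Boxes {X : Set} (R C : X → ℕ) where
  L : X → ℕ
  L j = R j ⊓ C j
  H : X → ℕ
  H j = R j ⊔ C j
  Sub : X → X → Set
  Sub j k = L k ≤ L j × H j ≤ H k
  SameBox : X → X → Set
  SameBox j k = L j ≡ L k × H j ≡ H k
  IsMax : X → Set
  IsMax = Maximal L H

  L≤R : ∀ j → L j ≤ R j
  L≤R j = m⊓n≤m (R j) (C j)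
  L≤C : ∀ j → L j ≤ C j
  L≤C j = m⊓n≤n (R j) (C j)
  R≤H : ∀ j → R j ≤ H j
  R≤H j = m≤m⊔n (R j) (C j)
  C≤H : ∀ j → C j ≤ H j
  C≤H j = m≤n⊔m (R j) (C j)

  upL : ∀ {j} → R j ≤ C j → L j ≡ R j
  upL = m≤n⇒m⊓n≡m
  upH : ∀ {j} → R j ≤ C j → H j ≡ C j
  upH = m≤n⇒m⊔n≡n
  dnL : ∀ {j} → C j ≤ R j → L j ≡ C j
  dnL = m≥n⇒m⊓n≡n
  dnH : ∀ {j} → C j ≤ R j → H j ≡ R j
  dnH = m≥n⇒m⊔n≡m

  sub-cases : ∀ k {a b} → L k ≤ a → b ≤ H k → (R k ≤ a × b ≤ C k) ⊎ (C k ≤ a × b ≤ R k)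
  sub-cases k p q with ≤-total (R k) (C k)
  ... | inj₁ le = inj₁ (subst (_≤ _) (upL le) p , subst (_ ≤_) (upH le) q)
  ... | inj₂ le = inj₂ (subst (_≤ _) (dnL le) p , subst (_ ≤_) (dnH le) q)

  cases-sub : ∀ k {a b} → (R k ≤ a × b ≤ C k) ⊎ (C k ≤ a × b ≤ R k) → L k ≤ a × b ≤ H k
  cases-sub k (inj₁ (p , q)) = ≤-trans (L≤R k) p , ≤-trans q (C≤H k)
  cases-sub k (inj₂ (p , q)) = ≤-trans (L≤C k) p , ≤-trans q (R≤H k)

  mirror-same : ∀ {j k} → R k ≡ C j → C k ≡ R j → SameBox j k
  mirror-same {j} {k} e1 e2 = trans (⊓-comm (R j) (C j)) (sym (cong₂ _⊓_ e1 e2)) ,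
                              trans (⊔-comm (R j) (C j)) (sym (cong₂ _⊔_ e1 e2))

  -- Maximal boxes are totally ordered: their low and high corners move together.
  nested-high : ∀ {j k} → IsMax k → L j ≤ L k → H j ≤ H k
  nested-high {j} {k} sk le with ≤-total (H j) (H k)
  ... | inj₁ h = h
  ... | inj₂ h = ≤-reflexive (sym (proj₂ (sk j (le , h))))

  nested-low : ∀ {j k} → IsMax j → H j ≤ H k → L j ≤ L k
  nested-low {j} {k} sj le with ≤-total (L j) (L k)
  ... | inj₁ h = h
  ... | inj₂ h = ≤-reflexive (proj₁ (sj k (h , le)))

≤-pred-≡ : ∀ {a b x y} → suc a ≡ x → suc b ≡ y → x ≤ y → a ≤ b
≤-pred-≡ refl refl le = ≤-pred le

-- Cells (a , b) and (a' , b') lie on the same side of the diagonal (above,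
-- on, or below it); this is what decides the colour of a bounding box.
SameShape : ℕ → ℕ → ℕ → ℕ → Set
SameShape a b a' b' = (a < b ⇔ a' < b') × (a ≡ b ⇔ a' ≡ b') × (b < a ⇔ b' < a')

flip-≡ : ∀ {a b a' b' : ℕ} → (a ≡ b ⇔ a' ≡ b') → (b ≡ a ⇔ b' ≡ a')
flip-≡ e = mk⇔ (sym ∘ to e ∘ sym) (sym ∘ from e ∘ sym)

shape-swap : ∀ {a b a' b'} → SameShape a b a' b' → SameShape b a b' a'
shape-swap (up , diag , dn) = dn , flip-≡ diag , up

-- A horizontal cut at height X is crossed upward by the cells with r < X ≤ c
-- and downward by those with c < X ≤ r, equally often.  We need the weak form:
-- two upward crossings force a downward one avoiding any prescribed column v.
-- Proof: otherwise sending each column t < X to the row of its cell (and the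
-- column v to the row of the first upward crossing) injects X columns into the
-- X - 1 rows below X other than that of the second crossing.
module Crossings {n : ℕ} (f g ginv : Fin n → Fin n)
  (finj : ∀ {a b} → f a ≡ f b → a ≡ b) (ginvr : ∀ t → g (ginv t) ≡ t) where

  r : Fin n → ℕ
  r j = toℕ (f j)
  c : Fin n → ℕ
  c j = toℕ (g j)

  rinj : ∀ {a b} → r a ≡ r b → a ≡ b
  rinj e = finj (toℕ-injective e)

  module Pigeonhole (v X' : ℕ) (a1 a2 : Fin n) (ne : a1 ≢ a2) (r1 : r a1 < suc X') (c1 : suc X' ≤ c a1)
           (r2 : r a2 < suc X') (c2 : suc X' ≤ c a2)
           (none : ¬ ∃ λ p → c p ≢ v × c p < suc X' × suc X' ≤ r p) where
    X : ℕ
    X = suc X'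
    X≤n : X ≤ n
    X≤n = <⇒≤ (≤-<-trans c1 (toℕ<n (g a1)))
    inFin : Fin X → Fin n
    inFin t = fromℕ< (<-≤-trans (toℕ<n t) X≤n)
    cellIn : Fin X → Fin n
    cellIn t = ginv (inFin t)
    c-cellIn : ∀ t → c (cellIn t) ≡ toℕ t
    c-cellIn t = trans (cong toℕ (ginvr (inFin t))) (toℕ-fromℕ< _)
    r-cellIn< : ∀ t → toℕ t ≢ v → r (cellIn t) < X
    r-cellIn< t t≢v = ≰⇒> (λ le → none (cellIn t , (λ e → t≢v (trans (sym (c-cellIn t)) e)) ,
                                         subst (_< X) (sym (c-cellIn t)) (toℕ<n t) , le))
    rowOf : (t : Fin X) → Dec (toℕ t ≡ v) → ℕ
    rowOf t (yes _) = r a1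
    rowOf t (no _) = r (cellIn t)
    rowOf< : ∀ t d → rowOf t d < X
    rowOf< t (yes _) = r1
    rowOf< t (no t≢v) = r-cellIn< t t≢v
    rowOf≢a2 : ∀ t d → rowOf t d ≢ r a2
    rowOf≢a2 t (yes _) e = ne (rinj e)
    rowOf≢a2 t (no _) e = <-irrefl refl (<-≤-trans (subst (_< X) (trans (sym (c-cellIn t)) (cong c (rinj e))) (toℕ<n t)) c2)
    a1-not-cellIn : ∀ t → a1 ≡ cellIn t → ⊥
    a1-not-cellIn t e = <-irrefl refl (<-≤-trans (subst (_< X) (trans (sym (c-cellIn t)) (cong c (sym e))) (toℕ<n t)) c1)
    rowOf-injective : ∀ t1 t2 d1 d2 → rowOf t1 d1 ≡ rowOf t2 d2 → t1 ≡ t2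
    rowOf-injective t1 t2 (yes e1) (yes e2) _ = toℕ-injective (trans e1 (sym e2))
    rowOf-injective t1 t2 (yes _) (no _) e = ⊥-elim (a1-not-cellIn t2 (rinj e))
    rowOf-injective t1 t2 (no _) (yes _) e = ⊥-elim (a1-not-cellIn t1 (rinj (sym e)))
    rowOf-injective t1 t2 (no _) (no _) e = toℕ-injective (trans (sym (c-cellIn t1)) (trans (cong c (rinj e)) (c-cellIn t2)))
    rowOfF : Fin X → Fin X
    rowOfF t = fromℕ< (rowOf< t (toℕ t ≟ v))
    a2≢rowOfF : ∀ t → fromℕ< r2 ≢ rowOfF t
    a2≢rowOfF t e = rowOf≢a2 t (toℕ t ≟ v) (trans (sym (toℕ-fromℕ< _)) (trans (cong toℕ (sym e)) (toℕ-fromℕ< _)))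
    squeeze : Fin X → Fin X'
    squeeze t = punchOut (a2≢rowOfF t)
    absurd : ⊥
    absurd with pigeonhole (n<1+n X') squeeze
    ... | t1 , t2 , lt , eq = <-irrefl (cong toℕ t1≡t2) lt
      where
      t1≡t2 : t1 ≡ t2
      t1≡t2 = rowOf-injective t1 t2 (toℕ t1 ≟ v) (toℕ t2 ≟ v)
                (trans (sym (toℕ-fromℕ< _)) (trans (cong toℕ (punchOut-injective (a2≢rowOfF t1) (a2≢rowOfF t2) eq)) (toℕ-fromℕ< _)))

  crossing : ∀ (X v : ℕ) (a1 a2 : Fin n) → a1 ≢ a2 → r a1 < X → X ≤ c a1 → r a2 < X → X ≤ c a2 →
          Σ (Fin n) λ p → c p ≢ v × c p < X × X ≤ r p
  crossing zero v a1 a2 ne () c1 r2 c2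
  crossing (suc X') v a1 a2 ne r1 c1 r2 c2 with any? (λ p → ¬? (c p ≟ v) ×-dec (c p <? suc X') ×-dec (suc X' ≤? r p))
  ... | yes (p , h) = p , h
  ... | no none = ⊥-elim (Pigeonhole.absurd v X' a1 a2 ne r1 c1 r2 c2 none)

-- The cells j ↦ (r j , c j) form a permutation
-- matrix (r, c injective, crossings balance) avoiding 3412; the cell i at
-- (I , W) with I ≤ W is deleted, the cell k0 lies north-east of it, and the
-- other cells move to (R' j , C' j).
module Deletion {n : ℕ} (r c : Fin n → ℕ)
  (rinj : ∀ {a b} → r a ≡ r b → a ≡ b)
  (cinj : ∀ {a b} → c a ≡ c b → a ≡ b)
  (crossing : ∀ (X v : ℕ) (a1 a2 : Fin n) → a1 ≢ a2 → r a1 < X → X ≤ c a1 → r a2 < X → X ≤ c a2 →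
           Σ (Fin n) λ p → c p ≢ v × c p < X × X ≤ r p)
  (no3412 : ∀ a b d e → r a < r b → r b < r d → r d < r e → c d < c e → c e < c a → c a < c b → ⊥)
  (i k0 : Fin n) (k0r : r k0 < r i) (k0c : c i < c k0) (IW : r i ≤ c i)
  where

  I : ℕ
  I = r i
  W : ℕ
  W = c i
  R' : Fin n → ℕ
  R' j = shift I (r j)
  C' : Fin n → ℕ
  C' j = shift W (c j)

  open TwoGaps IW
  module w = Boxes r c
  module U = Boxes R' C'

  SpanW : Fin n → Set
  SpanW = w.IsMax
  -- after the deletion the cell i is gone, so it is not a competitor
  SpanU : Fin n → Set
  SpanU j = ∀ k → i ≢ k → U.Sub j k → U.SameBox j k

  OutsideBand : Fin n → Set
  OutsideBand j = w.L j < I ⊎ W < w.H j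

  rowShift : ∀ {j} → i ≢ j → Shifted I (r j) (R' j)
  rowShift {j} ij = shifted I (r j) (λ e → ij (sym (rinj e)))
  colShift : ∀ {j} → i ≢ j → Shifted W (c j) (C' j)
  colShift {j} ij = shifted W (c j) (λ e → ij (sym (cinj e)))

  R'le : ∀ {j} → r j ≤ I → R' j ≡ r j
  R'le = shift-below
  R'hi : ∀ {j} → I < r j → suc (R' j) ≡ r j
  R'hi = shift-above
  C'le : ∀ {j} → c j ≤ W → C' j ≡ c j
  C'le = shift-below
  C'hi : ∀ {j} → W < c j → suc (C' j) ≡ c j
  C'hi = shift-above

  i≢k0 : i ≢ k0
  i≢k0 e = <-irrefl (cong r (sym e)) k0r

  i≢col<W : ∀ {p} → c p < W → i ≢ p
  i≢col<W lt e = <-irrefl (cong c (sym e)) lt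

  -- i and k0 cross every cut I < X ≤ W upward, hence some cell crosses it downward
  band-crossing : ∀ X v → I < X → X ≤ W → Σ (Fin n) λ p → c p ≢ v × c p < X × X ≤ r p
  band-crossing X v IX XW = crossing X v k0 i (λ e → i≢k0 (sym e)) (<-trans k0r IX) (≤-trans XW (<⇒≤ k0c)) IX XW

  Li≡I : w.L i ≡ I
  Li≡I = w.upL IW
  Hi≡W : w.H i ≡ W
  Hi≡W = w.upH IW

  not-inside-i : ∀ {j} → w.Sub j i → OutsideBand j → ⊥
  not-inside-i (a , b) (inj₁ lt) = <-irrefl refl (<-≤-trans lt (subst (_≤ _) Li≡I a))
  not-inside-i (a , b) (inj₂ lt) = <-irrefl refl (<-≤-trans lt (subst (_ ≤_) Hi≡W b))

  -- a box inside [I , W]² is properly contained in the box of k0, before ...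
  band-not-spanningW : ∀ {j} → I ≤ w.L j → w.H j ≤ W → ¬ SpanW j
  band-not-spanningW {j} a b sw = <-irrefl (sym (proj₁ (sw k0 (<⇒≤ lt , sub2)))) lt
    where
    lt : w.L k0 < w.L j
    lt = <-≤-trans (≤-<-trans (w.L≤R k0) k0r) a
    sub2 : w.H j ≤ w.H k0
    sub2 = ≤-trans b (≤-trans (<⇒≤ k0c) (w.C≤H k0))

  I≤R' : ∀ {j} → i ≢ j → I ≤ r j → I ≤ R' j
  I≤R' ij a with rowShift ij
  ... | below lt _ = ⊥-elim (<-irrefl refl (<-≤-trans lt a))
  ... | above lt e = ≤-pred (subst (I <_) (sym e) lt)

  I≤C' : ∀ {j} → i ≢ j → I ≤ c j → I ≤ C' j
  I≤C' ij a with colShift ij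
  ... | below _ e = subst (I ≤_) (sym e) a
  ... | above lt e = ≤-trans IW (≤-pred (subst (W <_) (sym e) lt))

  W≤C'k0 : W ≤ C' k0
  W≤C'k0 = ≤-pred (subst (W <_) (sym (C'hi k0c)) k0c)

  R'k0≡ : R' k0 ≡ r k0
  R'k0≡ = R'le (<⇒≤ k0r)

  -- ... and after the deletion
  band-not-spanningU : ∀ {j} → i ≢ j → I ≤ w.L j → w.H j ≤ W → ¬ SpanU j
  band-not-spanningU {j} ij a b su = <-irrefl (sym (proj₁ (su k0 i≢k0 (<⇒≤ lt , sub2)))) lt
    where
    lj : I ≤ U.L j
    lj = ⊓-glb (I≤R' ij (≤-trans a (w.L≤R j))) (I≤C' ij (≤-trans a (w.L≤C j)))
    lt : U.L k0 < U.L j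
    lt = <-≤-trans (≤-<-trans (U.L≤R k0) (subst (_< I) (sym R'k0≡) k0r)) lj
    hj : U.H j ≤ W
    hj = ⊔-lub (≤-trans (shifted-≤ (rowShift ij)) (≤-trans (w.R≤H j) b))
               (≤-trans (shifted-≤ (colShift ij)) (≤-trans (w.C≤H j) b))
    sub2 : U.H j ≤ U.H k0
    sub2 = ≤-trans hj (≤-trans W≤C'k0 (U.C≤H k0))

  spanning-outside-band : ∀ {j} → SpanW j → OutsideBand j
  spanning-outside-band {j} sw with I ≤? w.L j
  ... | no q = inj₁ (≰⇒> q)
  ... | yes a with w.H j ≤? W
  ... | yes b = ⊥-elim (band-not-spanningW a b sw)
  ... | no q = inj₂ (≰⇒> q)

  i-not-spanning : ¬ SpanW i
  i-not-spanning = band-not-spanningW (≤-reflexive (sym Li≡I)) (≤-reflexive Hi≡W)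

  same-boxW : ∀ {j k} → j ≡ k → w.SameBox j k
  same-boxW refl = refl , refl
  same-boxU : ∀ {j k} → j ≡ k → U.SameBox j k
  same-boxU refl = refl , refl

  inside-band-absurd : ∀ {j} → I ≤ r j → r j ≤ W → I ≤ c j → c j ≤ W → OutsideBand j → ⊥
  inside-band-absurd a b a' b' (inj₁ lt) = <-irrefl refl (<-≤-trans lt (⊓-glb a a'))
  inside-band-absurd a b a' b' (inj₂ lt) = <-irrefl refl (<-≤-trans lt (⊔-lub b b'))

  enclosedU-dn : ∀ {j} → SpanU j → ∀ p → i ≢ p → C' p < U.L j → U.H j ≤ R' p → ⊥
  enclosedU-dn {j} su p ip a b = <-irrefl (sym (proj₁ s)) lt
    where
    lt : U.L p < U.L j
    lt = ≤-<-trans (U.L≤C p) a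
    s : U.SameBox j p
    s = su p ip (<⇒≤ lt , ≤-trans b (U.R≤H p))

  enclosedU-up : ∀ {j} → SpanU j → ∀ p → i ≢ p → R' p < U.L j → U.H j ≤ C' p → ⊥
  enclosedU-up {j} su p ip a b = <-irrefl (sym (proj₁ s)) lt
    where
    lt : U.L p < U.L j
    lt = ≤-<-trans (U.L≤R p) a
    s : U.SameBox j p
    s = su p ip (<⇒≤ lt , ≤-trans b (U.C≤H p))

  enclosedW-dn : ∀ {j} → SpanW j → ∀ p → c p < w.L j → w.H j ≤ r p → ⊥
  enclosedW-dn {j} sw p a b = <-irrefl (sym (proj₁ s)) lt
    where
    lt : w.L p < w.L j
    lt = ≤-<-trans (w.L≤C p) a
    s : w.SameBox j p
    s = sw p (<⇒≤ lt , ≤-trans b (w.R≤H p))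

  enclosedW-up : ∀ {j} → SpanW j → ∀ p → r p < w.L j → w.H j ≤ c p → ⊥
  enclosedW-up {j} sw p a b = <-irrefl (sym (proj₁ s)) lt
    where
    lt : w.L p < w.L j
    lt = ≤-<-trans (w.L≤R p) a
    s : w.SameBox j p
    s = sw p (<⇒≤ lt , ≤-trans b (w.C≤H p))

  outside-band-up : ∀ {j} → r j < c j → OutsideBand j → r j < I ⊎ W < c j
  outside-band-up up (inj₁ x) = inj₁ (subst (_< I) (w.upL (<⇒≤ up)) x)
  outside-band-up up (inj₂ x) = inj₂ (subst (W <_) (w.upH (<⇒≤ up)) x)

  outside-band-dn : ∀ {j} → c j < r j → OutsideBand j → c j < I ⊎ W < r j
  outside-band-dn dn (inj₁ x) = inj₁ (subst (_< I) (w.dnL (<⇒≤ dn)) x)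
  outside-band-dn dn (inj₂ x) = inj₂ (subst (W <_) (w.dnH (<⇒≤ dn)) x)

  -- Four configurations, for a cell j above the diagonal whose box is maximal
  -- after the deletion and a cell k on the other side, in which the shifts
  -- distort the mirror relation between j and k (the name records the
  -- offending equation).  Each is refuted by a downward crossing p of a
  -- suitable cut (band-crossing): p either encloses the box of j, or p, j, k
  -- and k0 or i form a 3412 pattern.
  noUpMirror-rj≡1+ck : ∀ j k → i ≢ j → i ≢ k → r j < c j → OutsideBand j → SpanU j →
       r j ≡ suc (c k) → I ≤ c k → c k < W → r k ≡ c j → ⊥
  noUpMirror-rj≡1+ck j k ij ik up nb su e1 Iy yW e2 with outside-band-up up nb
  ... | inj₁ rjI = <-irrefl refl (<-trans rjI (subst (I <_) (sym e1) (s≤s Iy)))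
  ... | inj₂ Wz with band-crossing (suc (c k)) (c k) (s≤s Iy) yW
  ... | p , pv , pX , Xp = case-p (<-cmp (r p) (c j))
    where
    cpy : c p < c k
    cpy = ≤∧≢⇒< (≤-pred pX) pv
    ip : i ≢ p
    ip = i≢col<W (<-trans cpy yW)
    Irj : I < r j
    Irj = subst (I <_) (sym e1) (s≤s Iy)
    up' : R' j < C' j
    up' = shift-< (rowShift ij) (colShift ij) up
    eL' : U.L j ≡ c k
    eL' = trans (U.upL (<⇒≤ up')) (suc-injective (trans (R'hi Irj) e1))
    eH' : suc (U.H j) ≡ c j
    eH' = trans (cong suc (U.upH (<⇒≤ up'))) (C'hi Wz)
    rjrp : r j < r p
    rjrp = ≤∧≢⇒< (subst (_≤ r p) (sym e1) Xp)
             (λ e → <-irrefl refl (<-trans (subst (λ t → c t < c k) (sym (rinj e)) cpy) (<-trans yW Wz)))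
    Irp : I < r p
    Irp = <-trans Irj rjrp
    ck0cj : c k0 < c j
    ck0cj with c j ≤? c k0
    ... | no q = ≰⇒> q
    ... | yes q = ⊥-elim (enclosedU-up su k0 i≢k0
                    (subst₂ _<_ (sym R'k0≡) (sym eL') (<-≤-trans k0r Iy))
                    (≤-pred-≡ eH' (C'hi k0c) q))
    case-p : Tri (r p < c j) (r p ≡ c j) (c j < r p) → ⊥
    case-p (tri< lt _ _) = no3412 k0 j p k (<-trans k0r Irj) rjrp (subst (r p <_) (sym e2) lt) cpy (<-trans yW k0c) ck0cj
    case-p (tri≈ _ e _) = pv (cong c (rinj (trans e (sym e2))))
    case-p (tri> _ _ gt) = enclosedU-dn su p ip
                         (subst₂ _<_ (sym (C'le (<⇒≤ (<-trans cpy yW)))) (sym eL') cpy)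
                         (≤-pred-≡ eH' (R'hi Irp) (<⇒≤ gt))

  noUpMirror-rk≡1+cj : ∀ j k → i ≢ j → i ≢ k → r j < c j → OutsideBand j → SpanU j →
       r k ≡ suc (c j) → I ≤ c j → c j < W → r j ≡ c k → ⊥
  noUpMirror-rk≡1+cj j k ij ik up nb su e1 Iy yW e2 with outside-band-up up nb
  ... | inj₂ Wz = <-irrefl refl (<-trans yW Wz)
  ... | inj₁ rjI with band-crossing (suc (c j)) (r j) (s≤s Iy) yW
  ... | p , pv , pX , Xp = case-p (<-cmp (c p) (r j))
    where
    cpy : c p < c j
    cpy = ≤∧≢⇒< (≤-pred pX)
            (λ e → <-irrefl refl (<-≤-trans (subst (λ t → r t < suc (c j)) (sym (cinj e)) (<-trans rjI (s≤s Iy))) Xp))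
    ip : i ≢ p
    ip = i≢col<W (<-trans cpy yW)
    up' : R' j < C' j
    up' = shift-< (rowShift ij) (colShift ij) up
    eL' : U.L j ≡ r j
    eL' = trans (U.upL (<⇒≤ up')) (R'le (<⇒≤ rjI))
    eH' : U.H j ≡ c j
    eH' = trans (U.upH (<⇒≤ up')) (C'le (<⇒≤ yW))
    Irp : I < r p
    Irp = <-≤-trans (s≤s Iy) Xp
    rkrp : r k < r p
    rkrp = ≤∧≢⇒< (subst (_≤ r p) (sym e1) Xp) (λ e → pv (trans (cong c (sym (rinj e))) (sym e2)))
    case-p : Tri (c p < r j) (c p ≡ r j) (r j < c p) → ⊥
    case-p (tri< lt _ _) = enclosedU-dn su p ip
                         (subst₂ _<_ (sym (C'le (<⇒≤ (<-trans cpy yW)))) (sym eL') lt)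
                         (subst (_≤ R' p) (sym eH') (≤-pred-≡ refl (R'hi Irp) Xp))
    case-p (tri≈ _ e _) = pv e
    case-p (tri> _ _ gt) = no3412 j i k p rjI (subst (I <_) (sym e1) (s≤s Iy)) rkrp (subst (_< c p) e2 gt) cpy yW

  noUpMirror-ck≡rj : ∀ j k → i ≢ j → i ≢ k → r j < c j → OutsideBand j → SpanU j →
       c k ≡ r j → I < r j → r j < W → c j ≤ r k → ⊥
  noUpMirror-ck≡rj j k ij ik up nb su e Irj rjW b with outside-band-up up nb
  ... | inj₁ rjI = <-irrefl refl (<-trans rjI Irj)
  ... | inj₂ Wz with band-crossing (r j) (pred (r j)) Irj (<⇒≤ rjW)
  ... | p , pv , pX , Xp = case-p (<-cmp (r p) (c j))
    where
    scp : suc (c p) < r j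
    scp = ≤∧≢⇒< pX (λ e' → pv (cong pred e'))
    cpW : c p < W
    cpW = <-trans pX rjW
    ip : i ≢ p
    ip = i≢col<W cpW
    up' : R' j < C' j
    up' = shift-< (rowShift ij) (colShift ij) up
    eL' : suc (U.L j) ≡ r j
    eL' = trans (cong suc (U.upL (<⇒≤ up'))) (R'hi Irj)
    eH' : suc (U.H j) ≡ c j
    eH' = trans (cong suc (U.upH (<⇒≤ up'))) (C'hi Wz)
    rjrp : r j < r p
    rjrp = ≤∧≢⇒< Xp (λ e' → <-irrefl refl (<-trans (subst (λ t → c t < W) (sym (rinj e')) cpW) Wz))
    Irp : I < r p
    Irp = <-trans Irj rjrp
    a : C' p < U.L j
    a = subst (_< U.L j) (sym (C'le (<⇒≤ cpW))) (≤-pred (subst (suc (c p) <_) (sym eL') scp))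
    b' : c j ≤ r p → U.H j ≤ R' p
    b' = ≤-pred-≡ eH' (R'hi Irp)
    case-p : Tri (r p < c j) (r p ≡ c j) (c j < r p) → ⊥
    case-p (tri< lt _ _) = no3412 i j p k Irj rjrp (<-≤-trans lt b) (subst (c p <_) (sym e) pX) (subst (_< W) (sym e) rjW) Wz
    case-p (tri≈ _ e' _) = enclosedU-dn su p ip a (b' (≤-reflexive (sym e')))
    case-p (tri> _ _ gt) = enclosedU-dn su p ip a (b' (<⇒≤ gt))

  noUpMirror-cj≡rk : ∀ j k → i ≢ j → i ≢ k → r j < c j → OutsideBand j → SpanU j →
       c j ≡ r k → I < r k → r k < W → c k ≤ r j → ⊥
  noUpMirror-cj≡rk j k ij ik up nb su e Irk rkW a with outside-band-up up nb
  ... | inj₂ Wz = <-irrefl refl (<-trans (subst (_< W) (sym e) rkW) Wz)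
  ... | inj₁ rjI with band-crossing (suc (c j)) (r j) (<-trans (subst (I <_) (sym e) Irk) (n<1+n _)) (subst (_< W) (sym e) rkW)
  ... | p , pv , pX , Xp = case-p (<-cmp (c p) (r j))
    where
    Icj : I < c j
    Icj = subst (I <_) (sym e) Irk
    cjW : c j < W
    cjW = subst (_< W) (sym e) rkW
    cpcj : c p < c j
    cpcj = ≤∧≢⇒< (≤-pred pX)
             (λ e' → <-irrefl refl (<-≤-trans (subst (λ t → r t < suc (c j)) (sym (cinj e')) (<-trans rjI (<-trans Icj (n<1+n _)))) Xp))
    ip : i ≢ p
    ip = i≢col<W (<-trans cpcj cjW)
    Irp : I < r p
    Irp = <-trans Icj (<-≤-trans (n<1+n _) Xp)
    up' : R' j < C' j
    up' = shift-< (rowShift ij) (colShift ij) up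
    eL' : U.L j ≡ r j
    eL' = trans (U.upL (<⇒≤ up')) (R'le (<⇒≤ rjI))
    eH' : U.H j ≡ c j
    eH' = trans (U.upH (<⇒≤ up')) (C'le (<⇒≤ cjW))
    case-p : Tri (c p < r j) (c p ≡ r j) (r j < c p) → ⊥
    case-p (tri< lt _ _) = enclosedU-dn su p ip
                         (subst₂ _<_ (sym (C'le (<⇒≤ (<-trans cpcj cjW)))) (sym eL') lt)
                         (subst (_≤ R' p) (sym eH') (≤-pred-≡ refl (R'hi Irp) Xp))
    case-p (tri≈ _ e' _) = pv e'
    case-p (tri> _ _ gt) = no3412 j i k p rjI Irk (subst (_< r p) e (<-≤-trans (n<1+n _) Xp)) (≤-<-trans a gt) cpcj cjW

  -- A box containing
  -- that of j arises from a cell k on the same side (then k = j by injectivity)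
  -- or from the mirror side, where the shifts can break or create a mirror
  -- pair only in the four configurations above.
  up-w⇒u : ∀ j → i ≢ j → r j < c j → SpanW j → SpanU j
  up-w⇒u j ij up sw k ik sub' = case-side q
    where
    up' : R' j < C' j
    up' = shift-< (rowShift ij) (colShift ij) up
    eL' = U.upL (<⇒≤ up')
    eH' = U.upH (<⇒≤ up')
    eL = w.upL (<⇒≤ up)
    eH = w.upH (<⇒≤ up)
    q : (R' k ≤ R' j × C' j ≤ C' k) ⊎ (C' k ≤ R' j × C' j ≤ R' k)
    q = U.sub-cases k (subst (U.L k ≤_) eL' (proj₁ sub')) (subst (_≤ U.H k) eH' (proj₂ sub'))
    toSubW : (r k ≤ r j × c j ≤ c k) ⊎ (c k ≤ r j × c j ≤ r k) → w.Sub j k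
    toSubW x = subst (w.L k ≤_) (sym eL) (proj₁ (w.cases-sub k x)) , subst (_≤ w.H k) (sym eH) (proj₂ (w.cases-sub k x))
    case-side : (R' k ≤ R' j × C' j ≤ C' k) ⊎ (C' k ≤ R' j × C' j ≤ R' k) → U.SameBox j k
    case-side (inj₁ (a , b)) = same-boxU (rinj (≤-antisym rj≤rk rk≤rj))
      where
      rk≤rj : r k ≤ r j
      rk≤rj = unshift-mono (rowShift ik) (rowShift ij) a
      s : w.SameBox j k
      s = sw k (toSubW (inj₁ (rk≤rj , unshift-mono (colShift ij) (colShift ik) b)))
      rj≤rk : r j ≤ r k
      rj≤rk = ≤-trans (≤-reflexive (trans (sym eL) (proj₁ s))) (w.L≤R k)
    case-side (inj₂ (a , b)) = U.mirror-same e2 e1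
      where
      a0 : c k ≤ r j
      a0 = unshift-≥ (rowShift ij) (colShift ik) a
      b0 : c j ≤ r k
      b0 = unshift-≥ (rowShift ik) (colShift ij) b
      s : w.SameBox j k
      s = sw k (toSubW (inj₂ (a0 , b0)))
      ck≡rj : c k ≡ r j
      ck≡rj = ≤-antisym a0 (≤-trans (≤-reflexive (trans (sym eL) (proj₁ s))) (w.L≤C k))
      rk≡cj : r k ≡ c j
      rk≡cj = ≤-antisym (≤-trans (w.R≤H k) (≤-reflexive (trans (sym (proj₂ s)) eH))) b0
      e1 : C' k ≡ R' j
      e1 = ≤-antisym a (shift-≤ (rowShift ij) (colShift ik) (≤-reflexive (sym ck≡rj)))
      e2 : R' k ≡ C' j
      e2 = ≤-antisym (shift-≤ (rowShift ik) (colShift ij) (≤-reflexive rk≡cj)) b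

  up-u⇒w : ∀ j → i ≢ j → r j < c j → OutsideBand j → SpanU j → SpanW j
  up-u⇒w j ij up nb su k sub = case-i≟k (i ≟F k)
    where
    up' : R' j < C' j
    up' = shift-< (rowShift ij) (colShift ij) up
    eL' = U.upL (<⇒≤ up')
    eH' = U.upH (<⇒≤ up')
    eL = w.upL (<⇒≤ up)
    eH = w.upH (<⇒≤ up)
    q : (r k ≤ r j × c j ≤ c k) ⊎ (c k ≤ r j × c j ≤ r k)
    q = w.sub-cases k (subst (w.L k ≤_) eL (proj₁ sub)) (subst (_≤ w.H k) eH (proj₂ sub))
    toSubU : (R' k ≤ R' j × C' j ≤ C' k) ⊎ (C' k ≤ R' j × C' j ≤ R' k) → U.Sub j k
    toSubU x = subst (U.L k ≤_) (sym eL') (proj₁ (U.cases-sub k x)) , subst (_≤ U.H k) (sym eH') (proj₂ (U.cases-sub k x))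
    mirror-pair : i ≢ k → C' k ≤ R' j → C' j ≤ R' k → w.SameBox j k
    mirror-pair ik a' b' = case-shift (unshift-≡ (rowShift ij) (colShift ik) (sym e1)) (unshift-≡ (rowShift ik) (colShift ij) e2)
      where
      s : U.SameBox j k
      s = su k ik (toSubU (inj₂ (a' , b')))
      e1 : C' k ≡ R' j
      e1 = ≤-antisym a' (≤-trans (≤-reflexive (trans (sym eL') (proj₁ s))) (U.L≤C k))
      e2 : R' k ≡ C' j
      e2 = ≤-antisym (≤-trans (U.R≤H k) (≤-reflexive (trans (sym (proj₂ s)) eH'))) b'
      case-shift : r j ≡ c k ⊎ (r j ≡ suc (c k) × I ≤ c k × c k < W) →
           r k ≡ c j ⊎ (r k ≡ suc (c j) × I ≤ c j × c j < W) → w.SameBox j k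
      case-shift (inj₁ x1) (inj₁ x2) = w.mirror-same x2 (sym x1)
      case-shift (inj₂ (B1 , Iy , yW)) (inj₁ x2) = ⊥-elim (noUpMirror-rj≡1+ck j k ij ik up nb su B1 Iy yW x2)
      case-shift (inj₁ x1) (inj₂ (B2 , Iy , yW)) = ⊥-elim (noUpMirror-rk≡1+cj j k ij ik up nb su B2 Iy yW x1)
      case-shift (inj₂ (B1 , Iy , _)) (inj₂ (_ , _ , cjW)) with outside-band-up up nb
      ... | inj₁ rjI = ⊥-elim (<-irrefl refl (<-trans rjI (subst (I <_) (sym B1) (s≤s Iy))))
      ... | inj₂ Wz = ⊥-elim (<-irrefl refl (<-trans cjW Wz))
    case-side : i ≢ k → (r k ≤ r j × c j ≤ c k) ⊎ (c k ≤ r j × c j ≤ r k) → w.SameBox j k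
    case-side ik (inj₁ (a , b)) = same-boxW (rinj (≤-antisym rj≤rk a))
      where
      s : U.SameBox j k
      s = su k ik (toSubU (inj₁ (shift-mono (rowShift ik) (rowShift ij) a , shift-mono (colShift ij) (colShift ik) b)))
      rj≤rk : r j ≤ r k
      rj≤rk = unshift-mono (rowShift ij) (rowShift ik) (≤-trans (≤-reflexive (trans (sym eL') (proj₁ s))) (U.L≤R k))
    case-side ik (inj₂ (a , b)) with shift-≥ (rowShift ij) (colShift ik) a | shift-≥ (rowShift ik) (colShift ij) b
    ... | inj₂ (e , Irj , rjW) | _ = ⊥-elim (noUpMirror-ck≡rj j k ij ik up nb su e Irj rjW b)
    ... | inj₁ _ | inj₂ (e , Irk , rkW) = ⊥-elim (noUpMirror-cj≡rk j k ij ik up nb su e Irk rkW a)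
    ... | inj₁ a' | inj₁ b' = mirror-pair ik a' b'
    case-i≟k : Dec (i ≡ k) → w.SameBox j k
    case-i≟k (yes refl) = ⊥-elim (not-inside-i sub nb)
    case-i≟k (no ik) = case-side ik q

  dn-preserved : ∀ {j} → i ≢ j → c j < r j → OutsideBand j → C' j < R' j
  dn-preserved {j} ij dn nb with C' j <? R' j
  ... | yes p = p
  ... | no q with unshift-≤ (rowShift ij) (colShift ij) (≮⇒≥ q)
  ... | inj₁ le = ⊥-elim (<⇒≱ dn le)
  ... | inj₂ (e , Iy , yW) with outside-band-dn dn nb
  ... | inj₁ cjI = ⊥-elim (<-irrefl refl (<-≤-trans cjI Iy))
  ... | inj₂ Wr = ⊥-elim (<-irrefl refl (<-≤-trans Wr (subst (_≤ W) (sym e) yW)))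

  noDnMirror-rk∈band : ∀ j k → i ≢ j → i ≢ k → c j < r j → OutsideBand j → SpanW j →
       r k ≡ c j → c k ≡ r j → I < r k → r k < W → ⊥
  noDnMirror-rk∈band j k ij ik dn nb sw e1 e2 Irk rkW with outside-band-dn dn nb
  ... | inj₁ cjI = <-irrefl refl (<-trans cjI (subst (I <_) e1 Irk))
  ... | inj₂ Wr with band-crossing (r k) (r k) Irk (<⇒≤ rkW)
  ... | p , _ , pX , Xp = case-p (<-cmp (r p) (r j))
    where
    rkrp : r k < r p
    rkrp = ≤∧≢⇒< Xp (λ e → <-irrefl refl (<-trans (<-trans (subst (λ t → c t < r k) (sym (rinj e)) pX) rkW)
                                                    (subst (W <_) (sym e2) Wr)))
    case-p : Tri (r p < r j) (r p ≡ r j) (r j < r p) → ⊥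
    case-p (tri< lt _ _) = no3412 i k p j Irk rkrp lt (subst (c p <_) e1 pX) (subst (_< W) e1 rkW) (subst (W <_) (sym e2) Wr)
    case-p (tri≈ _ e _) = <-irrefl (trans (cong c (rinj e)) (sym e1)) pX
    case-p (tri> _ _ gt) = enclosedW-dn sw p (subst (c p <_) (trans e1 (sym (w.dnL (<⇒≤ dn)))) pX)
                                      (subst (_≤ r p) (sym (w.dnH (<⇒≤ dn))) (<⇒≤ gt))

  noDnMirror-rj∈band : ∀ j k → i ≢ j → i ≢ k → c j < r j → OutsideBand j → SpanW j →
       r k ≡ c j → c k ≡ r j → I < r j → r j < W → ⊥
  noDnMirror-rj∈band j k ij ik dn nb sw e1 e2 Irj rjW with outside-band-dn dn nb
  ... | inj₂ Wr = <-irrefl refl (<-trans rjW Wr)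
  ... | inj₁ cjI with band-crossing (suc (r j)) (c j) (<-trans Irj (n<1+n _)) rjW
  ... | p , pv , pX , Xp = case-p (<-cmp (c p) (c j))
    where
    cprj : c p < r j
    cprj = ≤∧≢⇒< (≤-pred pX)
             (λ e → <-irrefl refl (<-≤-trans (subst (λ t → r t < suc (r j)) (sym (cinj (trans e (sym e2))))
                                               (subst (_< suc (r j)) (sym e1) (<-trans cjI (<-trans Irj (n<1+n _))))) Xp))
    case-p : Tri (c p < c j) (c p ≡ c j) (c j < c p) → ⊥
    case-p (tri< lt _ _) = enclosedW-dn sw p (subst (c p <_) (sym (w.dnL (<⇒≤ dn))) lt)
                                      (subst (_≤ r p) (sym (w.dnH (<⇒≤ dn))) (<⇒≤ Xp))
    case-p (tri≈ _ e _) = pv e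
    case-p (tri> _ _ gt) = no3412 k i j p (subst (_< I) (sym e1) cjI) Irj Xp gt (subst (c p <_) (sym e2) cprj) (subst (_< W) (sym e2) rjW)

  noDnMirror-rk≡1+cj : ∀ j k → i ≢ j → i ≢ k → c j < r j → OutsideBand j → SpanW j →
       r k ≡ suc (c j) → I ≤ c j → c j < W → r j ≤ c k → ⊥
  noDnMirror-rk≡1+cj j k ij ik dn nb sw e1 Iy yW b0 with outside-band-dn dn nb
  ... | inj₁ cjI = <-irrefl refl (<-≤-trans cjI Iy)
  ... | inj₂ Wr with band-crossing (suc (c j)) (c j) (s≤s Iy) yW
  ... | p , pv , pX , Xp = case-p (<-cmp (r p) (r j))
    where
    cpy : c p < c j
    cpy = ≤∧≢⇒< (≤-pred pX) pv
    rkrp : r k < r p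
    rkrp = ≤∧≢⇒< (subst (_≤ r p) (sym e1) Xp)
             (λ e → <-irrefl refl (<-trans (<-trans cpy yW) (<-≤-trans Wr (subst (r j ≤_) (cong c (rinj e)) b0))))
    eL : w.L j ≡ c j
    eL = w.dnL (<⇒≤ dn)
    eH : w.H j ≡ r j
    eH = w.dnH (<⇒≤ dn)
    ck0rj : c k0 < r j
    ck0rj with r j ≤? c k0
    ... | no q = ≰⇒> q
    ... | yes q = ⊥-elim (enclosedW-up sw k0 (subst (r k0 <_) (sym eL) (<-≤-trans k0r Iy)) (subst (_≤ c k0) (sym eH) q))
    case-p : Tri (r p < r j) (r p ≡ r j) (r j < r p) → ⊥
    case-p (tri< lt _ _) = no3412 k0 k p j (subst (r k0 <_) (sym e1) (<-≤-trans k0r (≤-trans Iy (n≤1+n _))))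
                             rkrp lt cpy (<-trans yW k0c) (<-≤-trans ck0rj b0)
    case-p (tri≈ _ e _) = pv (cong c (rinj e))
    case-p (tri> _ _ gt) = enclosedW-dn sw p (subst (c p <_) (sym eL) cpy) (subst (_≤ r p) (sym eH) (<⇒≤ gt))

  noDnMirror-rj≡1+ck : ∀ j k → i ≢ j → i ≢ k → c j < r j → OutsideBand j → SpanW j →
       r j ≡ suc (c k) → I ≤ c k → c k < W → r k ≤ c j → ⊥
  noDnMirror-rj≡1+ck j k ij ik dn nb sw e1 Iy yW a0 with outside-band-dn dn nb
  ... | inj₂ Wr = <-irrefl refl (<-≤-trans Wr (subst (_≤ W) (sym e1) yW))
  ... | inj₁ cjI with band-crossing (suc (c k)) (c j) (s≤s Iy) yW
  ... | p , pv , pX , Xp = case-p (<-cmp (c p) (c j))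
    where
    cpck : c p < c k
    cpck = ≤∧≢⇒< (≤-pred pX)
             (λ e → <-irrefl refl (<-≤-trans (subst (λ t → r t < suc (c k)) (sym (cinj e))
                                              (≤-<-trans a0 (<-≤-trans cjI (≤-trans Iy (n≤1+n _))))) Xp))
    rjrp : r j < r p
    rjrp = ≤∧≢⇒< (subst (_≤ r p) (sym e1) Xp) (λ e → pv (cong c (sym (rinj e))))
    eL : w.L j ≡ c j
    eL = w.dnL (<⇒≤ dn)
    eH : w.H j ≡ r j
    eH = w.dnH (<⇒≤ dn)
    case-p : Tri (c p < c j) (c p ≡ c j) (c j < c p) → ⊥
    case-p (tri< lt _ _) = enclosedW-dn sw p (subst (c p <_) (sym eL) lt) (subst (_≤ r p) (sym eH) (<⇒≤ rjrp))
    case-p (tri≈ _ e _) = pv e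
    case-p (tri> _ _ gt) = no3412 k i j p (≤-<-trans a0 cjI) (subst (I <_) (sym e1) (s≤s Iy)) rjrp gt cpck yW

  dn-w⇒u : ∀ j → i ≢ j → c j < r j → OutsideBand j → SpanW j → SpanU j
  dn-w⇒u j ij dn nb sw k ik sub' = case-side q
    where
    dn' : C' j < R' j
    dn' = dn-preserved ij dn nb
    eL' = U.dnL (<⇒≤ dn')
    eH' = U.dnH (<⇒≤ dn')
    eL = w.dnL (<⇒≤ dn)
    eH = w.dnH (<⇒≤ dn)
    q : (R' k ≤ C' j × R' j ≤ C' k) ⊎ (C' k ≤ C' j × R' j ≤ R' k)
    q = U.sub-cases k (subst (U.L k ≤_) eL' (proj₁ sub')) (subst (_≤ U.H k) eH' (proj₂ sub'))
    toSubW : (r k ≤ c j × r j ≤ c k) ⊎ (c k ≤ c j × r j ≤ r k) → w.Sub j k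
    toSubW x = subst (w.L k ≤_) (sym eL) (proj₁ (w.cases-sub k x)) , subst (_≤ w.H k) (sym eH) (proj₂ (w.cases-sub k x))
    mirror-pair : r k ≤ c j → r j ≤ c k → U.SameBox j k
    mirror-pair a0 b0 = case-shift (shift-≡ (rowShift ik) (colShift ij) rk≡cj) (shift-≡ (rowShift ij) (colShift ik) (sym ck≡rj))
      where
      s : w.SameBox j k
      s = sw k (toSubW (inj₁ (a0 , b0)))
      rk≡cj : r k ≡ c j
      rk≡cj = ≤-antisym a0 (≤-trans (≤-reflexive (trans (sym eL) (proj₁ s))) (w.L≤R k))
      ck≡rj : c k ≡ r j
      ck≡rj = ≤-antisym (≤-trans (w.C≤H k) (≤-reflexive (trans (sym (proj₂ s)) eH))) b0
      case-shift : R' k ≡ C' j ⊎ (I < r k × r k < W) → R' j ≡ C' k ⊎ (I < r j × r j < W) → U.SameBox j k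
      case-shift (inj₁ x1) (inj₁ x2) = U.mirror-same x1 (sym x2)
      case-shift (inj₂ (Irk , rkW)) _ = ⊥-elim (noDnMirror-rk∈band j k ij ik dn nb sw rk≡cj ck≡rj Irk rkW)
      case-shift (inj₁ _) (inj₂ (Irj , rjW)) = ⊥-elim (noDnMirror-rj∈band j k ij ik dn nb sw rk≡cj ck≡rj Irj rjW)
    case-side : (R' k ≤ C' j × R' j ≤ C' k) ⊎ (C' k ≤ C' j × R' j ≤ R' k) → U.SameBox j k
    case-side (inj₂ (a , b)) = same-boxU (sym (cinj (≤-antisym ck≤cj cj≤ck)))
      where
      ck≤cj : c k ≤ c j
      ck≤cj = unshift-mono (colShift ik) (colShift ij) a
      s : w.SameBox j k
      s = sw k (toSubW (inj₂ (ck≤cj , unshift-mono (rowShift ij) (rowShift ik) b)))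
      cj≤ck : c j ≤ c k
      cj≤ck = ≤-trans (≤-reflexive (trans (sym eL) (proj₁ s))) (w.L≤C k)
    case-side (inj₁ (a , b)) with unshift-≤ (rowShift ik) (colShift ij) a | unshift-≤ (rowShift ij) (colShift ik) b
    ... | inj₁ a0 | inj₁ b0 = mirror-pair a0 b0
    ... | inj₁ a0 | inj₂ (B2 , Iy , yW) = ⊥-elim (noDnMirror-rj≡1+ck j k ij ik dn nb sw B2 Iy yW a0)
    ... | inj₂ (B1 , Iy , yW) | inj₁ b0 = ⊥-elim (noDnMirror-rk≡1+cj j k ij ik dn nb sw B1 Iy yW b0)
    ... | inj₂ (B1 , Iy , yW) | inj₂ (B2 , _ , ckW) with outside-band-dn dn nb
    ...   | inj₁ cjI = ⊥-elim (<-irrefl refl (<-≤-trans cjI Iy))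
    ...   | inj₂ Wr = ⊥-elim (<-irrefl refl (<-≤-trans Wr (subst (_≤ W) (sym B2) ckW)))

  dn-u⇒w : ∀ j → i ≢ j → c j < r j → OutsideBand j → SpanU j → SpanW j
  dn-u⇒w j ij dn nb su k sub = case-i≟k (i ≟F k)
    where
    dn' : C' j < R' j
    dn' = dn-preserved ij dn nb
    eL' = U.dnL (<⇒≤ dn')
    eH' = U.dnH (<⇒≤ dn')
    eL = w.dnL (<⇒≤ dn)
    eH = w.dnH (<⇒≤ dn)
    q : (r k ≤ c j × r j ≤ c k) ⊎ (c k ≤ c j × r j ≤ r k)
    q = w.sub-cases k (subst (w.L k ≤_) eL (proj₁ sub)) (subst (_≤ w.H k) eH (proj₂ sub))
    toSubU : (R' k ≤ C' j × R' j ≤ C' k) ⊎ (C' k ≤ C' j × R' j ≤ R' k) → U.Sub j k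
    toSubU x = subst (U.L k ≤_) (sym eL') (proj₁ (U.cases-sub k x)) , subst (_≤ U.H k) (sym eH') (proj₂ (U.cases-sub k x))
    case-side : i ≢ k → (r k ≤ c j × r j ≤ c k) ⊎ (c k ≤ c j × r j ≤ r k) → w.SameBox j k
    case-side ik (inj₂ (a , b)) = same-boxW (sym (cinj (≤-antisym a cj≤ck)))
      where
      s : U.SameBox j k
      s = su k ik (toSubU (inj₂ (shift-mono (colShift ik) (colShift ij) a , shift-mono (rowShift ij) (rowShift ik) b)))
      cj≤ck : c j ≤ c k
      cj≤ck = unshift-mono (colShift ij) (colShift ik) (≤-trans (≤-reflexive (trans (sym eL') (proj₁ s))) (U.L≤C k))
    case-side ik (inj₁ (a , b)) = case-shift (unshift-≡ (rowShift ik) (colShift ij) e1) (unshift-≡ (rowShift ij) (colShift ik) (sym e2))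
      where
      a' : R' k ≤ C' j
      a' = shift-≤ (rowShift ik) (colShift ij) a
      b' = shift-≤ (rowShift ij) (colShift ik) b
      s : U.SameBox j k
      s = su k ik (toSubU (inj₁ (a' , b')))
      e1 : R' k ≡ C' j
      e1 = ≤-antisym a' (≤-trans (≤-reflexive (trans (sym eL') (proj₁ s))) (U.L≤R k))
      e2 : C' k ≡ R' j
      e2 = ≤-antisym (≤-trans (U.C≤H k) (≤-reflexive (trans (sym (proj₂ s)) eH'))) b'
      case-shift : r k ≡ c j ⊎ (r k ≡ suc (c j) × I ≤ c j × c j < W) →
           r j ≡ c k ⊎ (r j ≡ suc (c k) × I ≤ c k × c k < W) → w.SameBox j k
      case-shift (inj₁ x1) (inj₁ x2) = w.mirror-same x1 (sym x2)
      case-shift (inj₂ (B , _ , _)) _ = ⊥-elim (<-irrefl refl (<-≤-trans (subst (c j <_) (sym B) (n<1+n _)) a))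
      case-shift (inj₁ _) (inj₂ (B , _ , _)) = ⊥-elim (<-irrefl refl (<-≤-trans (subst (c k <_) (sym B) (n<1+n _)) b))
    case-i≟k : Dec (i ≡ k) → w.SameBox j k
    case-i≟k (yes refl) = ⊥-elim (not-inside-i sub nb)
    case-i≟k (no ik) = case-side ik q

  diag-preserved : ∀ {j} → i ≢ j → r j ≡ c j → OutsideBand j → R' j ≡ C' j
  diag-preserved {j} ij fj nb with shift-≡ (rowShift ij) (colShift ij) fj
  ... | inj₁ e = e
  ... | inj₂ (Irj , rjW) = ⊥-elim (inside-band-absurd (<⇒≤ Irj) (<⇒≤ rjW)
                             (subst (I ≤_) fj (<⇒≤ Irj)) (subst (_≤ W) fj (<⇒≤ rjW)) nb)

  diag-w⇒u : ∀ j → i ≢ j → r j ≡ c j → OutsideBand j → SpanW j → SpanU j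
  diag-w⇒u j ij fj nb sw k ik sub' = case-side q
    where
    fj' : R' j ≡ C' j
    fj' = diag-preserved ij fj nb
    eL' = U.upL (≤-reflexive fj')
    eH' = U.upH (≤-reflexive fj')
    eL = w.upL (≤-reflexive fj)
    eH = w.upH (≤-reflexive fj)
    q : (R' k ≤ R' j × C' j ≤ C' k) ⊎ (C' k ≤ R' j × C' j ≤ R' k)
    q = U.sub-cases k (subst (U.L k ≤_) eL' (proj₁ sub')) (subst (_≤ U.H k) eH' (proj₂ sub'))
    toSubW : (r k ≤ r j × c j ≤ c k) ⊎ (c k ≤ r j × c j ≤ r k) → w.Sub j k
    toSubW x = subst (w.L k ≤_) (sym eL) (proj₁ (w.cases-sub k x)) , subst (_≤ w.H k) (sym eH) (proj₂ (w.cases-sub k x))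
    case-side : (R' k ≤ R' j × C' j ≤ C' k) ⊎ (C' k ≤ R' j × C' j ≤ R' k) → U.SameBox j k
    case-side (inj₁ (a , b)) = same-boxU (rinj (≤-antisym rj≤rk rk≤rj))
      where
      rk≤rj : r k ≤ r j
      rk≤rj = unshift-mono (rowShift ik) (rowShift ij) a
      s : w.SameBox j k
      s = sw k (toSubW (inj₁ (rk≤rj , unshift-mono (colShift ij) (colShift ik) b)))
      rj≤rk : r j ≤ r k
      rj≤rk = ≤-trans (≤-reflexive (trans (sym eL) (proj₁ s))) (w.L≤R k)
    case-side (inj₂ (a , b)) = same-boxU (sym (cinj (≤-antisym ck≤cj cj≤ck)))
      where
      ck≤cj : c k ≤ c j
      ck≤cj = unshift-mono (colShift ik) (colShift ij) (subst (C' k ≤_) fj' a)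
      rj≤rk : r j ≤ r k
      rj≤rk = unshift-mono (rowShift ij) (rowShift ik) (subst (_≤ R' k) (sym fj') b)
      s : w.SameBox j k
      s = sw k (toSubW (inj₂ (subst (c k ≤_) (sym fj) ck≤cj , subst (_≤ r k) fj rj≤rk)))
      cj≤ck : c j ≤ c k
      cj≤ck = subst (_≤ c k) fj (≤-trans (≤-reflexive (trans (sym eL) (proj₁ s))) (w.L≤C k))

  diag-u⇒w : ∀ j → i ≢ j → r j ≡ c j → OutsideBand j → SpanU j → SpanW j
  diag-u⇒w j ij fj nb su k sub = case-i≟k (i ≟F k)
    where
    fj' : R' j ≡ C' j
    fj' = diag-preserved ij fj nb
    eL' = U.upL (≤-reflexive fj')
    eH' = U.upH (≤-reflexive fj')
    eL = w.upL (≤-reflexive fj)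
    eH = w.upH (≤-reflexive fj)
    q : (r k ≤ r j × c j ≤ c k) ⊎ (c k ≤ r j × c j ≤ r k)
    q = w.sub-cases k (subst (w.L k ≤_) eL (proj₁ sub)) (subst (_≤ w.H k) eH (proj₂ sub))
    toSubU : (R' k ≤ R' j × C' j ≤ C' k) ⊎ (C' k ≤ R' j × C' j ≤ R' k) → U.Sub j k
    toSubU x = subst (U.L k ≤_) (sym eL') (proj₁ (U.cases-sub k x)) , subst (_≤ U.H k) (sym eH') (proj₂ (U.cases-sub k x))
    case-side : i ≢ k → (r k ≤ r j × c j ≤ c k) ⊎ (c k ≤ r j × c j ≤ r k) → w.SameBox j k
    case-side ik (inj₁ (a , b)) = same-boxW (rinj (≤-antisym rj≤rk a))
      where
      s : U.SameBox j k
      s = su k ik (toSubU (inj₁ (shift-mono (rowShift ik) (rowShift ij) a , shift-mono (colShift ij) (colShift ik) b)))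
      rj≤rk : r j ≤ r k
      rj≤rk = unshift-mono (rowShift ij) (rowShift ik) (≤-trans (≤-reflexive (trans (sym eL') (proj₁ s))) (U.L≤R k))
    case-side ik (inj₂ (a , b)) = same-boxW (sym (cinj (≤-antisym ck≤cj cj≤ck)))
      where
      ck≤cj : c k ≤ c j
      ck≤cj = subst (c k ≤_) fj a
      rj≤rk : r j ≤ r k
      rj≤rk = subst (_≤ r k) (sym fj) b
      C'k≤C'j : C' k ≤ C' j
      C'k≤C'j = shift-mono (colShift ik) (colShift ij) ck≤cj
      R'j≤R'k : R' j ≤ R' k
      R'j≤R'k = shift-mono (rowShift ij) (rowShift ik) rj≤rk
      s : U.SameBox j k
      s = su k ik (toSubU (inj₂ (subst (C' k ≤_) (sym fj') C'k≤C'j , subst (_≤ R' k) fj' R'j≤R'k)))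
      cj≤ck : c j ≤ c k
      cj≤ck = unshift-mono (colShift ij) (colShift ik)
                (subst (_≤ C' k) fj' (≤-trans (≤-reflexive (trans (sym eL') (proj₁ s))) (U.L≤C k)))
    case-i≟k : Dec (i ≡ k) → w.SameBox j k
    case-i≟k (yes refl) = ⊥-elim (not-inside-i sub nb)
    case-i≟k (no ik) = case-side ik q

  transfer-by-side : ∀ j → i ≢ j → OutsideBand j → (SpanW j → SpanU j) × (SpanU j → SpanW j)
  transfer-by-side j ij nb with <-cmp (r j) (c j)
  ... | tri< up _ _ = up-w⇒u j ij up , up-u⇒w j ij up nb
  ... | tri≈ _ fj _ = diag-w⇒u j ij fj nb , diag-u⇒w j ij fj nb
  ... | tri> _ _ dn = dn-w⇒u j ij dn nb , dn-u⇒w j ij dn nb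

  -- (1): the box of j ≠ i is maximal before the deletion iff it is after;
  -- boxes inside the band are maximal at neither time.
  spanning-transfer : ∀ j → i ≢ j → (SpanW j → SpanU j) × (SpanU j → SpanW j)
  spanning-transfer j ij with I ≤? w.L j | w.H j ≤? W
  ... | yes a | yes b = (λ sw → ⊥-elim (band-not-spanningW a b sw)) , (λ su → ⊥-elim (band-not-spanningU ij a b su))
  ... | no q | _ = transfer-by-side j ij (inj₁ (≰⇒> q))
  ... | yes _ | no q = transfer-by-side j ij (inj₂ (≰⇒> q))

  Moves : ℕ → ℕ → Set
  Moves x x' = (x' ≡ x × x ≤ W) ⊎ (suc x' ≡ x × I < x)

  row-moves : ∀ {j} → i ≢ j → Moves (r j) (R' j)
  row-moves ij with rowShift ij
  ... | below lt e = inj₁ (e , <⇒≤ (<-≤-trans lt IW))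
  ... | above lt e = inj₂ (e , lt)

  col-moves : ∀ {j} → i ≢ j → Moves (c j) (C' j)
  col-moves ij with colShift ij
  ... | below lt e = inj₁ (e , <⇒≤ lt)
  ... | above lt e = inj₂ (e , ≤-<-trans IW lt)

  box-moves : ∀ {j} → i ≢ j → OutsideBand j → Moves (w.L j) (U.L j) × Moves (w.H j) (U.H j)
  box-moves {j} ij nb with <-cmp (r j) (c j)
  ... | tri< up _ _ = let up' = shift-< (rowShift ij) (colShift ij) up in
      subst₂ Moves (sym (w.upL (<⇒≤ up))) (sym (U.upL (<⇒≤ up'))) (row-moves ij) ,
      subst₂ Moves (sym (w.upH (<⇒≤ up))) (sym (U.upH (<⇒≤ up'))) (col-moves ij)
  ... | tri≈ _ fj _ = let fj' = diag-preserved ij fj nb in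
      subst₂ Moves (sym (w.upL (≤-reflexive fj))) (sym (U.upL (≤-reflexive fj'))) (row-moves ij) ,
      subst₂ Moves (sym (w.upH (≤-reflexive fj))) (sym (U.upH (≤-reflexive fj'))) (col-moves ij)
  ... | tri> _ _ dn = let dn' = dn-preserved ij dn nb in
      subst₂ Moves (sym (w.dnL (<⇒≤ dn))) (sym (U.dnL (<⇒≤ dn'))) (col-moves ij) ,
      subst₂ Moves (sym (w.dnH (<⇒≤ dn))) (sym (U.dnH (<⇒≤ dn'))) (row-moves ij)

  moves-differ : ∀ {x a b} → Moves x a → Moves x b → a ≢ b → I < x × x ≤ W
  moves-differ (inj₁ (e1 , _)) (inj₁ (e2 , _)) ne = ⊥-elim (ne (trans e1 (sym e2)))
  moves-differ (inj₁ (_ , xW)) (inj₂ (_ , Ix)) ne = Ix , xW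
  moves-differ (inj₂ (_ , Ix)) (inj₁ (_ , xW)) ne = Ix , xW
  moves-differ (inj₂ (e1 , _)) (inj₂ (e2 , _)) ne = ⊥-elim (ne (suc-injective (trans e1 (sym e2))))

  moves-≤ : ∀ {x a} → Moves x a → a ≤ x
  moves-≤ (inj₁ (refl , _)) = ≤-refl
  moves-≤ (inj₂ (refl , _)) = n≤1+n _

  moves-≥ : ∀ {x a} → Moves x a → x ≤ suc a
  moves-≥ (inj₁ (refl , _)) = n≤1+n _
  moves-≥ (inj₂ (refl , _)) = ≤-refl

  moves-mono : ∀ {x a z b} → Moves x a → Moves z b → x < z → a ≤ b
  moves-mono ga gb lt = ≤-pred (≤-trans (s≤s (moves-≤ ga)) (≤-trans lt (moves-≥ gb)))

  moves-collide : ∀ {x a z b} → Moves x a → Moves z b → x < z → a ≡ b → I ≤ x × x ≤ W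
  moves-collide (inj₁ (refl , _)) (inj₁ (refl , _)) lt refl = ⊥-elim (<-irrefl refl lt)
  moves-collide (inj₁ (refl , xW)) (inj₂ (refl , Iz)) lt refl = ≤-pred Iz , xW
  moves-collide (inj₂ (refl , _)) (inj₁ (refl , _)) lt refl = ⊥-elim (<-irrefl refl (<-trans lt (n<1+n _)))
  moves-collide (inj₂ (refl , _)) (inj₂ (refl , _)) lt refl = ⊥-elim (<-irrefl refl lt)

  moves-above : ∀ {x a} → Moves x a → W < x → suc a ≡ x
  moves-above (inj₁ (_ , xW)) Wx = ⊥-elim (<-irrefl refl (<-≤-trans Wx xW))
  moves-above (inj₂ (e , _)) _ = e

  moves-below : ∀ {x a} → Moves x a → x < I → a ≡ x
  moves-below (inj₁ (e , _)) _ = e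
  moves-below (inj₂ (_ , Ix)) xI = ⊥-elim (<-irrefl refl (<-trans xI Ix))

  -- Two spanning cells j, k: equal boxes stay equal (well-definedness of β)
  -- and the order of the low corners is kept ((3)).  Distinct maximal boxes
  -- differ in both corners, which rules out the collisions the shift could cause.
  module TwoSpanning (j k : Fin n) (ij : i ≢ j) (ik : i ≢ k) (swj : SpanW j) (swk : SpanW k) where
    suj : SpanU j
    suj = proj₁ (spanning-transfer j ij) swj
    suk : SpanU k
    suk = proj₁ (spanning-transfer k ik) swk
    nbj : OutsideBand j
    nbj = spanning-outside-band swj
    nbk : OutsideBand k
    nbk = spanning-outside-band swk
    gLj : Moves (w.L j) (U.L j)
    gLj = proj₁ (box-moves ij nbj)
    gHj : Moves (w.H j) (U.H j)
    gHj = proj₂ (box-moves ij nbj)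
    gLk : Moves (w.L k) (U.L k)
    gLk = proj₁ (box-moves ik nbk)
    gHk : Moves (w.H k) (U.H k)
    gHk = proj₂ (box-moves ik nbk)

    same-high : U.H j ≡ U.H k → U.L j ≢ U.L k → ⊥
    same-high eh ne with <-cmp (U.L j) (U.L k)
    ... | tri< lt _ _ = ne (sym (proj₁ (suk j ij (<⇒≤ lt , ≤-reflexive (sym eh)))))
    ... | tri≈ _ e _ = ne e
    ... | tri> _ _ gt = ne (proj₁ (suj k ik (<⇒≤ gt , ≤-reflexive eh)))

    same-low : U.L j ≡ U.L k → U.H j ≢ U.H k → ⊥
    same-low el ne with <-cmp (U.H j) (U.H k)
    ... | tri< lt _ _ = ne (proj₂ (suj k ik (≤-reflexive (sym el) , <⇒≤ lt)))
    ... | tri≈ _ e _ = ne e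
    ... | tri> _ _ gt = ne (sym (proj₂ (suk j ij (≤-reflexive el , <⇒≤ gt))))

    -- (3): a collision of low corners would force the high corners apart
    -- within a single maximal box
    low-order-preserved : w.L j < w.L k → U.L j < U.L k
    low-order-preserved lt = ≤∧≢⇒< (moves-mono gLj gLk lt) contra
      where
      hh : w.H j < w.H k
      hh = ≤∧≢⇒< (w.nested-high swk (<⇒≤ lt)) (λ e → <⇒≱ lt (w.nested-low swk (≤-reflexive (sym e))))
      contra : U.L j ≢ U.L k
      contra e with moves-collide gLj gLk lt e | nbj
      ... | (IL , _) | inj₁ LI = <-irrefl refl (<-≤-trans LI IL)
      ... | _ | inj₂ WH = <-irrefl (proj₂ (suj k ik (≤-reflexive (sym e) , <⇒≤ h'))) h'
        where
        h' : U.H j < U.H k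
        h' = ≤∧≢⇒< (moves-mono gHj gHk hh)
               (λ e' → <-irrefl refl (<-≤-trans WH (proj₂ (moves-collide gHj gHk hh e'))))

    -- a corner can only change differently for j and k inside the band, where
    -- the other corner of the spanning box lies outside it and agrees
    same-box-preserved : w.SameBox j k → U.SameBox j k
    same-box-preserved (eL , eH) = lpart , hpart
      where
      gLk' : Moves (w.L j) (U.L k)
      gLk' = subst (λ x → Moves x (U.L k)) (sym eL) gLk
      gHk' : Moves (w.H j) (U.H k)
      gHk' = subst (λ x → Moves x (U.H k)) (sym eH) gHk
      lpart : U.L j ≡ U.L k
      lpart with U.L j ≟ U.L k
      ... | yes e = e
      ... | no ne with moves-differ gLj gLk' ne | nbj
      ... | (Ix , _) | inj₁ LI = ⊥-elim (<-irrefl refl (<-trans LI Ix))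
      ... | _ | inj₂ WH = ⊥-elim (same-high (suc-injective (trans (moves-above gHj WH) (sym (moves-above gHk' WH)))) ne)
      hpart : U.H j ≡ U.H k
      hpart with U.H j ≟ U.H k
      ... | yes e = e
      ... | no ne with moves-differ gHj gHk' ne | nbj
      ... | (_ , xW) | inj₂ WH = ⊥-elim (<-irrefl refl (<-≤-trans WH xW))
      ... | _ | inj₁ LI = ⊥-elim (same-low (trans (moves-below gLj LI) (sym (moves-below gLk' LI))) ne)

  -- injectivity of β: since the order of low corners is strict, it is reflected
  same-box-reflected : ∀ j k → i ≢ j → i ≢ k → SpanW j → SpanW k → U.SameBox j k → w.SameBox j k
  same-box-reflected j k ij ik swj swk (eL' , _) with <-cmp (w.L j) (w.L k)
  ... | tri< lt _ _ = ⊥-elim (<-irrefl eL' (TwoSpanning.low-order-preserved j k ij ik swj swk lt))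
  ... | tri> _ _ gt = ⊥-elim (<-irrefl (sym eL') (TwoSpanning.low-order-preserved k j ik ij swk swj gt))
  ... | tri≈ _ eL _ = eL , ≤-antisym (w.nested-high swk (≤-reflexive eL)) (w.nested-high swj (≤-reflexive (sym eL)))

  orientation-preserved : ∀ j → i ≢ j → OutsideBand j → SameShape (r j) (c j) (R' j) (C' j)
  orientation-preserved j ij nb =
    mk⇔ (shift-< (rowShift ij) (colShift ij)) up⇐up′ ,
    mk⇔ (λ f → diag-preserved ij f nb) diag⇐diag′ ,
    mk⇔ (λ dn → dn-preserved ij dn nb) (unshift-> (rowShift ij) (colShift ij))
    where
    up⇐up′ : R' j < C' j → r j < c j
    up⇐up′ lt with r j <? c j
    ... | yes p = p
    ... | no q with shift-≥ (rowShift ij) (colShift ij) (≮⇒≥ q)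
    ... | inj₁ le = ⊥-elim (<⇒≱ lt le)
    ... | inj₂ (e , Irj , rjW) = ⊥-elim (inside-band-absurd (<⇒≤ Irj) (<⇒≤ rjW)
                                   (subst (I ≤_) (sym e) (<⇒≤ Irj)) (subst (_≤ W) (sym e) (<⇒≤ rjW)) nb)
    diag⇐diag′ : R' j ≡ C' j → r j ≡ c j
    diag⇐diag′ e with unshift-≡ (rowShift ij) (colShift ij) e
    ... | inj₁ x = x
    ... | inj₂ (e' , Iy , yW) = ⊥-elim (inside-band-absurd (subst (I ≤_) (sym e') (≤-trans Iy (n≤1+n _)))
                                  (subst (_≤ W) (sym e') yW) Iy (<⇒≤ yW) nb)

maximal-ext : ∀ {X : Set} {L H L' H' : X → ℕ} → (∀ x → L x ≡ L' x) → (∀ x → H x ≡ H' x) →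
       ∀ j → Maximal L H j → Maximal L' H' j
maximal-ext {L = L} {H} {L'} {H'} eL eH j s k (a , b) =
  trans (sym (eL j)) (trans (proj₁ s') (eL k)) , trans (sym (eH j)) (trans (proj₂ s') (eH k))
  where
  s' : L j ≡ L k × H j ≡ H k
  s' = s k (subst₂ _≤_ (sym (eL k)) (sym (eL j)) a , subst₂ _≤_ (sym (eH j)) (sym (eH k)) b)

spanning⇒maximal : ∀ {n} (v : Permutation′ n) j → Spanning v j → Maximal (lo v) (hi v) j
spanning⇒maximal v j sp k sub with lo v j ≟ lo v k | hi v j ≟ hi v k
... | yes a | yes b = a , b
... | no a | _ = ⊥-elim (sp (k , sub , λ e → a (cong proj₁ e)))
... | yes _ | no b = ⊥-elim (sp (k , sub , λ e → b (cong proj₂ e)))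

maximal⇒spanning : ∀ {n} (v : Permutation′ n) j → Maximal (lo v) (hi v) j → Spanning v j
maximal⇒spanning v j s (k , sub , ne) = ne (cong₂ _,_ (proj₁ (s k sub)) (proj₂ (s k sub)))

record Transfer {m : ℕ} (w : Permutation′ (suc m)) (i : Fin (suc m)) (u : Permutation′ m) : Set where
  field
    spanning-iff : ∀ j (p : i ≢ j) → Spanning w j ⇔ Spanning u (δ i p)
    deleted-not-spanning : ¬ Spanning w i
    same-box-preserved : ∀ j j' (p : i ≢ j) (p' : i ≢ j') → Spanning w j → Spanning w j' →
      Box w j ≡ Box w j' → Box u (δ i p) ≡ Box u (δ i p')
    same-box-reflected : ∀ j j' (p : i ≢ j) (p' : i ≢ j') → Spanning w j → Spanning w j' →
      Box u (δ i p) ≡ Box u (δ i p') → Box w j ≡ Box w j'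
    low-order-preserved : ∀ j j' (p : i ≢ j) (p' : i ≢ j') → Spanning w j → Spanning w j' →
      lo w j < lo w j' → lo u (δ i p) < lo u (δ i p')
    shape-preserved : ∀ j (p : i ≢ j) → Spanning w j →
      SameShape (toℕ j) (val w j) (toℕ (δ i p)) (val u (δ i p))

module Consequences {m : ℕ} {w : Permutation′ (suc m)} {i : Fin (suc m)} {u : Permutation′ m}
  (T : Transfer w i u) where
  open Transfer T public

  spanning-avoids-row : ∀ j → Spanning w j → i ≢ j
  spanning-avoids-row j sp e = deleted-not-spanning (subst (Spanning w) (sym e) sp)

  i≢punchIn : ∀ (k : Fin m) → i ≢ punchIn i k
  i≢punchIn k = punchInᵢ≢i i k ∘ sym

  δ-punchIn : ∀ (k : Fin m) → δ i (i≢punchIn k) ≡ k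
  δ-punchIn k = punchOut-punchIn i

  β-surjective : ∀ k → Spanning u k →
    Σ (Fin (suc m)) λ j → Σ (i ≢ j) λ p → Spanning w j × (Box u (δ i p) ≡ Box u k)
  β-surjective k sp = punchIn i k , i≢punchIn k ,
    from (spanning-iff (punchIn i k) (i≢punchIn k)) (subst (Spanning u) (sym (δ-punchIn k)) sp) ,
    cong (Box u) (δ-punchIn k)

  ArisesW : (Fin (suc m) → Set) → ℕ × ℕ → Set
  ArisesW P B = Σ (Fin (suc m)) λ j → Spanning w j × (Box w j ≡ B) × P j
  ArisesU : (Fin m → Set) → ℕ × ℕ → Set
  ArisesU P B = Σ (Fin m) λ j → Spanning u j × (Box u j ≡ B) × P j

  β-preserves : (Pw : Fin (suc m) → Set) (Pu : Fin m → Set) →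
    (∀ j (p : i ≢ j) → Spanning w j → Pw j ⇔ Pu (δ i p)) →
    ∀ j (p : i ≢ j) → Spanning w j → ArisesW Pw (Box w j) ⇔ ArisesU Pu (Box u (δ i p))
  β-preserves Pw Pu P⇔ j p spj = mk⇔ forth back
    where
    forth : ArisesW Pw (Box w j) → ArisesU Pu (Box u (δ i p))
    forth (j2 , sp2 , eB , pj2) =
      δ i p2 , to (spanning-iff j2 p2) sp2 , same-box-preserved j2 j p2 p sp2 spj eB , to (P⇔ j2 p2 sp2) pj2
      where
      p2 : i ≢ j2
      p2 = spanning-avoids-row j2 sp2
    back : ArisesU Pu (Box u (δ i p)) → ArisesW Pw (Box w j)
    back (k , spk , eB , pk) =
      j2 , sp2 , same-box-reflected j2 j (i≢punchIn k) p sp2 spj (trans (cong (Box u) (δ-punchIn k)) eB) ,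
      from (P⇔ j2 (i≢punchIn k) sp2) (subst Pu (sym (δ-punchIn k)) pk)
      where
      j2 : Fin (suc m)
      j2 = punchIn i k
      sp2 : Spanning w j2
      sp2 = from (spanning-iff j2 (i≢punchIn k)) (subst (Spanning u) (sym (δ-punchIn k)) spk)

  β-colours : ∀ j (p : i ≢ j) → Spanning w j →
    (Red w (Box w j) ⇔ Red u (Box u (δ i p)))
    × (Green w (Box w j) ⇔ Green u (Box u (δ i p)))
    × (Blue w (Box w j) ⇔ Blue u (Box u (δ i p)))
    × (Purple w (Box w j) ⇔ Purple u (Box u (δ i p)))
  β-colours j p sp = red , green , blue ,
    mk⇔ (λ (x , y) → to red x , to blue y) (λ (x , y) → from red x , from blue y)
    where
    red : Red w (Box w j) ⇔ Red u (Box u (δ i p))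
    red = β-preserves (λ j → val w j < toℕ j) (λ k → val u k < toℕ k)
            (λ j p sp → proj₂ (proj₂ (shape-preserved j p sp))) j p sp
    green : Green w (Box w j) ⇔ Green u (Box u (δ i p))
    green = β-preserves (λ j → val w j ≡ toℕ j) (λ k → val u k ≡ toℕ k)
              (λ j p sp → flip-≡ (proj₁ (proj₂ (shape-preserved j p sp)))) j p sp
    blue : Blue w (Box w j) ⇔ Blue u (Box u (δ i p))
    blue = β-preserves (λ j → toℕ j < val w j) (λ k → toℕ k < val u k)
             (λ j p sp → proj₁ (shape-preserved j p sp)) j p sp

-- The Deletion module applied to a permutation w, with (r , c) either
-- (row , column) or, transposed, (column , row); lo/hi are expressed via r, c.
module Instance {m : ℕ} (w : Permutation′ (suc m)) (i : Fin (suc m)) (u : Permutation′ m)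
  (r c : Fin (suc m) → ℕ)
  (rinj : ∀ {a b} → r a ≡ r b → a ≡ b)
  (cinj : ∀ {a b} → c a ≡ c b → a ≡ b)
  (crossing : ∀ (X v : ℕ) (a1 a2 : Fin (suc m)) → a1 ≢ a2 → r a1 < X → X ≤ c a1 → r a2 < X → X ≤ c a2 →
           Σ (Fin (suc m)) λ p → c p ≢ v × c p < X × X ≤ r p)
  (no3412 : ∀ a b d e → r a < r b → r b < r d → r d < r e → c d < c e → c e < c a → c a < c b → ⊥)
  (k0 : Fin (suc m)) (k0r : r k0 < r i) (k0c : c i < c k0) (IW : r i ≤ c i)
  (eLo : ∀ j → r j ⊓ c j ≡ lo w j) (eHi : ∀ j → r j ⊔ c j ≡ hi w j)
  (eLoU : ∀ j (p : i ≢ j) → shift (r i) (r j) ⊓ shift (c i) (c j) ≡ lo u (δ i p))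
  (eHiU : ∀ j (p : i ≢ j) → shift (r i) (r j) ⊔ shift (c i) (c j) ≡ hi u (δ i p))
  (orient : ∀ j (p : i ≢ j) → SameShape (r j) (c j) (shift (r i) (r j)) (shift (c i) (c j)) →
            SameShape (toℕ j) (val w j) (toℕ (δ i p)) (val u (δ i p)))
  where

  module C = Deletion r c rinj cinj crossing no3412 i k0 k0r k0c IW

  toW : ∀ j → Spanning w j → C.SpanW j
  toW j sp = maximal-ext (λ x → sym (eLo x)) (λ x → sym (eHi x)) j (spanning⇒maximal w j sp)

  fromW : ∀ j → C.SpanW j → Spanning w j
  fromW j s = maximal⇒spanning w j (maximal-ext eLo eHi j s)

  toU : ∀ j (p : i ≢ j) → Spanning u (δ i p) → C.SpanU j
  toU j p sp k ik (a , b) = trans (eLoU j p) (trans (proj₁ s) (sym (eLoU k ik))) ,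
                            trans (eHiU j p) (trans (proj₂ s) (sym (eHiU k ik)))
    where
    s : lo u (δ i p) ≡ lo u (δ i ik) × hi u (δ i p) ≡ hi u (δ i ik)
    s = spanning⇒maximal u (δ i p) sp (δ i ik) (subst₂ _≤_ (eLoU k ik) (eLoU j p) a , subst₂ _≤_ (eHiU j p) (eHiU k ik) b)

  fromU : ∀ j (p : i ≢ j) → C.SpanU j → Spanning u (δ i p)
  fromU j p su = maximal⇒spanning u (δ i p) f
    where
    f : Maximal (lo u) (hi u) (δ i p)
    f k' (a , b) = trans (sym (eLoU j p)) (trans (proj₁ s) lk) , trans (sym (eHiU j p)) (trans (proj₂ s) hk)
      where
      k : Fin (suc m)
      k = punchIn i k'
      ik : i ≢ k
      ik = punchInᵢ≢i i k' ∘ sym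
      lk : shift (r i) (r k) ⊓ shift (c i) (c k) ≡ lo u k'
      lk = trans (eLoU k ik) (cong (lo u) (punchOut-punchIn i))
      hk : shift (r i) (r k) ⊔ shift (c i) (c k) ≡ hi u k'
      hk = trans (eHiU k ik) (cong (hi u) (punchOut-punchIn i))
      s : C.U.SameBox j k
      s = su k ik (subst₂ _≤_ (sym lk) (sym (eLoU j p)) a , subst₂ _≤_ (sym (eHiU j p)) (sym hk) b)

  same-box-preserved : ∀ j j' (p : i ≢ j) (p' : i ≢ j') → Spanning w j → Spanning w j' →
         Box w j ≡ Box w j' → Box u (δ i p) ≡ Box u (δ i p')
  same-box-preserved j j' p p' sj sj' e = cong₂ _,_ (trans (sym (eLoU j p)) (trans (proj₁ b) (eLoU j' p')))
                                    (trans (sym (eHiU j p)) (trans (proj₂ b) (eHiU j' p')))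
    where
    b : C.U.SameBox j j'
    b = C.TwoSpanning.same-box-preserved j j' p p' (toW j sj) (toW j' sj')
          (trans (eLo j) (trans (cong proj₁ e) (sym (eLo j'))) , trans (eHi j) (trans (cong proj₂ e) (sym (eHi j'))))

  same-box-reflected : ∀ j j' (p : i ≢ j) (p' : i ≢ j') → Spanning w j → Spanning w j' →
         Box u (δ i p) ≡ Box u (δ i p') → Box w j ≡ Box w j'
  same-box-reflected j j' p p' sj sj' e = cong₂ _,_ (trans (sym (eLo j)) (trans (proj₁ b) (eLo j')))
                                     (trans (sym (eHi j)) (trans (proj₂ b) (eHi j')))
    where
    b : C.w.SameBox j j'
    b = C.same-box-reflected j j' p p' (toW j sj) (toW j' sj')
          (trans (eLoU j p) (trans (cong proj₁ e) (sym (eLoU j' p'))) , trans (eHiU j p) (trans (cong proj₂ e) (sym (eHiU j' p'))))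

  low-order-preserved : ∀ j j' (p : i ≢ j) (p' : i ≢ j') → Spanning w j → Spanning w j' →
         lo w j < lo w j' → lo u (δ i p) < lo u (δ i p')
  low-order-preserved j j' p p' sj sj' lt = subst₂ _<_ (eLoU j p) (eLoU j' p')
    (C.TwoSpanning.low-order-preserved j j' p p' (toW j sj) (toW j' sj') (subst₂ _<_ (sym (eLo j)) (sym (eLo j')) lt))

  transfer : Transfer w i u
  transfer = record
    { spanning-iff = λ j p → mk⇔ (λ sp → fromU j p (proj₁ (C.spanning-transfer j p) (toW j sp)))
                                 (λ sp → fromW j (proj₂ (C.spanning-transfer j p) (toU j p sp)))
    ; deleted-not-spanning = λ sp → C.i-not-spanning (toW i sp)
    ; same-box-preserved = same-box-preserved
    ; same-box-reflected = same-box-reflected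
    ; low-order-preserved = low-order-preserved
    ; shape-preserved = λ j p sp → orient j p (C.orientation-preserved j p (C.spanning-outside-band (toW j sp)))
    }

perm-injective : ∀ {n} (w : Permutation′ n) {a b} → val w a ≡ val w b → a ≡ b
perm-injective w e = trans (sym (inverseˡ w)) (trans (cong (w ⟨$⟩ˡ_) (toℕ-injective e)) (inverseˡ w))

row-δ : ∀ {m} {i : Fin (suc m)} j (p : i ≢ j) → toℕ (δ i p) ≡ shift (toℕ i) (toℕ j)
row-δ j p = toℕ-punchOut p

col-δ : ∀ {m} (w : Permutation′ (suc m)) (i : Fin (suc m)) (u : Permutation′ m) →
  (∀ j (p : i ≢ j) → u ⟨$⟩ʳ δ i p ≡ δ (w ⟨$⟩ʳ i) (perm-≢ w p)) →
  ∀ j (p : i ≢ j) → val u (δ i p) ≡ shift (val w i) (val w j)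
col-δ w i u hu j p = trans (cong toℕ (hu j p)) (toℕ-punchOut (perm-≢ w p))

reshape : ∀ {a b a' b' x y} → a' ≡ x → b' ≡ y → SameShape a b x y → SameShape a b a' b'
reshape refl refl s = s

-- If i ≤ w_i the cell k < i with w_k > w_i lies north-east
-- of (i , w_i) and Deletion applies to (row , column); otherwise the cell l > i
-- with w_l < w_i does so for the transpose (column , row), 3412 being
-- invariant under transposition.
deletion-transfer : ∀ {m} (w : Permutation′ (suc m)) (i : Fin (suc m)) →
  Avoids3412 w → NonCorner w i → (u : Permutation′ m) →
  (∀ j (p : i ≢ j) → u ⟨$⟩ʳ δ i p ≡ δ (w ⟨$⟩ʳ i) (perm-≢ w p)) → Transfer w i u
deletion-transfer w i av (k , l , k<i , i<l , wi<wk , wl<wi) u hu with toℕ i ≤? val w i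
... | yes i≤wi = Instance.transfer w i u toℕ (val w) toℕ-injective (perm-injective w)
  (Crossings.crossing (λ j → j) (w ⟨$⟩ʳ_) (w ⟨$⟩ˡ_) (λ e → e) (λ _ → inverseʳ w))
  (λ a b d e h1 h2 h3 h4 h5 h6 → av (a , b , d , e , h1 , h2 , h3 , h4 , h5 , h6))
  k k<i wi<wk i≤wi (λ _ → refl) (λ _ → refl)
  (λ j p → sym (cong₂ _⊓_ (row-δ j p) (col-δ w i u hu j p)))
  (λ j p → sym (cong₂ _⊔_ (row-δ j p) (col-δ w i u hu j p)))
  (λ j p → reshape (row-δ j p) (col-δ w i u hu j p))
... | no i>wi = Instance.transfer w i u (val w) toℕ (perm-injective w) toℕ-injective
  (Crossings.crossing (w ⟨$⟩ʳ_) (λ j → j) (λ j → j) (perm-injective w ∘ cong toℕ) (λ _ → refl))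
  (λ a b d e h1 h2 h3 h4 h5 h6 → av (d , e , a , b , h4 , h5 , h6 , h1 , h2 , h3))
  l wl<wi i<l (<⇒≤ (≰⇒> i>wi)) (λ j → ⊓-comm (val w j) (toℕ j)) (λ j → ⊔-comm (val w j) (toℕ j))
  (λ j p → trans (⊓-comm (shift (val w i) (val w j)) (shift (toℕ i) (toℕ j)))
                 (sym (cong₂ _⊓_ (row-δ j p) (col-δ w i u hu j p))))
  (λ j p → trans (⊔-comm (shift (val w i) (val w j)) (shift (toℕ i) (toℕ j)))
                 (sym (cong₂ _⊔_ (row-δ j p) (col-δ w i u hu j p))))
  (λ j p → shape-swap ∘ reshape (col-δ w i u hu j p) (row-δ j p))

proposition5p12 : ∀ {m} (w : Permutation′ (suc m)) (i : Fin (suc m)) →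
    Avoids3412 w → NonCorner w i →
    (u : Permutation′ m) →
    (∀ j (p : i ≢ j) → u ⟨$⟩ʳ δ i p ≡ δ (w ⟨$⟩ʳ i) (perm-≢ w p)) →
    -- (1)
    (∀ j (p : i ≢ j) → Spanning w j ⇔ Spanning u (δ i p))
    -- (2) β well-defined: its domain avoids row i, and equal boxes have equal images
    × (∀ j → Spanning w j → i ≢ j)
    × (∀ j j' (p : i ≢ j) (p' : i ≢ j') → Spanning w j → Spanning w j' →
         Box w j ≡ Box w j' → Box u (δ i p) ≡ Box u (δ i p'))
    -- (2) β injective
    × (∀ j j' (p : i ≢ j) (p' : i ≢ j') → Spanning w j → Spanning w j' →
         Box u (δ i p) ≡ Box u (δ i p') → Box w j ≡ Box w j')
    -- (2) β surjective
    × (∀ k → Spanning u k →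
         Σ (Fin (suc m)) λ j → Σ (i ≢ j) λ p → Spanning w j × (Box u (δ i p) ≡ Box u k))
    -- (2) β colour-preserving
    × (∀ j (p : i ≢ j) → Spanning w j →
         (Red w (Box w j) ⇔ Red u (Box u (δ i p)))
         × (Green w (Box w j) ⇔ Green u (Box u (δ i p)))
         × (Blue w (Box w j) ⇔ Blue u (Box u (δ i p)))
         × (Purple w (Box w j) ⇔ Purple u (Box u (δ i p))))
    -- (3) β preserves the order by the row of the northwest corner
    × (∀ j j' (p : i ≢ j) (p' : i ≢ j') → Spanning w j → Spanning w j' →
         lo w j < lo w j' → lo u (δ i p) < lo u (δ i p'))
proposition5p12 w i av nc u hu =
  spanning-iff , spanning-avoids-row , same-box-preserved , same-box-reflected ,
  β-surjective , β-colours , low-order-preserved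
  where open Consequences (deletion-transfer w i av nc u hu)
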